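{- Let $n\ge 3$ and let $q$ be a prime power. Let $G$ be the point-hyperplane incidence graph of the $n$-dimensional projective space $\mathrm{PG}(n,q)$ (vertices are the points and the hyperplanes of $\mathrm{PG}(n,q)$, a point being adjacent to a hyperplane iff they are incident). Then $G$ is a bipartite $$egr\left(2\frac{q^{n+1}-1}{q-1},\ \frac{q^n-1}{q-1},\ 4,\ \frac{q^{2n-1}-q^{n+1}-q^{n}+q^2}{(q-1)^2}\right).$$ If $n=3$, then $G$ is an extremal bipartite egr-graph, i.e. its order equals $n_2(k,4,\lambda)$ for the corresponding parameters $k=\frac{q^3-1}{q-1}$ and $\lambda=\frac{q^{5}-q^{4}-q^{3}+q^2}{(q-1)^2}$.
   Context: All graphs are simple, finite and connected. A $(k,g)$-graph is a $k$-regular graph of girth $g$. An edge-girth-regular graph $egr(n,k,g,\lambda)$ is a $(k,g)$-graph on $n$ vertices in which every edge is contained in exactly $\lambda$ distinct cycles of length $g$. $n_2(k,g,\lambda)$ denotes the smallest order of a bipartite $egr(n,k,g,\lambda)$, and a bipartite $egr(n,k,g,\lambda)$ is extremal bipartite if $n=n_2(k,g,\lambda)$. -}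

module Defs where

open import Data.Nat using (ℕ; zero; suc; _≤_)
open import Data.Bool using (Bool; true; false)
open import Data.Empty using (⊥)
open import Data.Unit using (⊤)
open import Data.Product using (Σ; ∃; _×_; _,_; proj₁)
open import Data.Sum using (_⊎_; inj₁; inj₂)
open import Data.List using (List; []; _∷_; _++_; [_]; length)
open import Data.List.Membership.Propositional using (_∈_)
open import Data.List.Relation.Unary.Unique.Propositional using (Unique)
open import Data.List.Relation.Unary.Linked using (Linked)
open import Data.Vec using (Vec; []; _∷_)
open import Relation.Nullary using (¬_)
open import Relation.Binary.PropositionalEquality using (_≡_)
open import Relation.Binary.Definitions using (DecidableEquality)
open import Relation.Binary.Construct.Closure.ReflexiveTransitive using (Star)
open import Algebra.Core using (Op₁; Op₂)
open import Algebra.Structures using (IsCommutativeRing)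

HasCount : {A : Set} → (A → Set) → ℕ → Set
HasCount {A} P m =
  Σ (List A) λ L → Unique L × (∀ x → x ∈ L → P x) × (∀ x → P x → x ∈ L) × length L ≡ m

-- Simple graphs (finiteness is imposed through HasCount below)

record Graph : Set₁ where
  field
    V      : Set
    Adj    : V → V → Set
    sym    : ∀ {u v} → Adj u v → Adj v u
    irrefl : ∀ {v} → ¬ Adj v v

module _ (G : Graph) where
  open Graph G

  Connected : Set
  Connected = ∀ u v → Star Adj u v

  Closed : List V → Set
  Closed [] = ⊥
  Closed (x ∷ xs) = Linked Adj ((x ∷ xs) ++ [ x ])

  IsCycle : List V → Set
  IsCycle c = 3 ≤ length c × Unique c × Closed c

  HasGirth : ℕ → Set
  HasGirth g = (∃ λ c → IsCycle c × length c ≡ g) × (∀ c → IsCycle c → g ≤ length c)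

  -- traversals of g-cycles that start with the edge u → v; each g-cycle
  -- (as a subgraph) through the edge uv corresponds to exactly one such list
  CycleThrough : V → V → ℕ → List V → Set
  CycleThrough u v g c = IsCycle c × length c ≡ g × ∃ λ rest → c ≡ u ∷ v ∷ rest

  IsEgr : ℕ → ℕ → ℕ → ℕ → Set
  IsEgr N k g λ' =
    Connected
    × HasCount (λ (_ : V) → ⊤) N
    × (∀ v → HasCount (Adj v) k)
    × HasGirth g
    × (∀ u v → Adj u v → HasCount (CycleThrough u v g) λ')

  Bipartite : Set
  Bipartite = Σ (V → Bool) λ col → ∀ {u v} → Adj u v → ¬ col u ≡ col v

IsExtremalBipartiteEgr : Graph → ℕ → ℕ → ℕ → ℕ → Set₁
IsExtremalBipartiteEgr G N k g λ' =
  Bipartite G × IsEgr G N k g λ'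
  × (∀ (H : Graph) (M : ℕ) → Bipartite H → IsEgr H M k g λ' → N ≤ M)

record Field : Set₁ where
  field
    Carrier : Set
    _+_ _*_ : Op₂ Carrier
    -_ _⁻¹  : Op₁ Carrier
    0# 1#   : Carrier
    isCommutativeRing : IsCommutativeRing _≡_ _+_ _*_ -_ 0# 1#
    0≢1     : ¬ 0# ≡ 1#
    ⁻¹-inverse : ∀ x → ¬ x ≡ 0# → x * (x ⁻¹) ≡ 1#
    _≟_     : DecidableEquality Carrier

-- A point is a 1-dim subspace of F^{n+1}, represented by its unique
-- spanning vector whose first nonzero coordinate is 1.  A hyperplane is
-- {x | a₀x₀ + … + aₙxₙ = 0} for a nonzero a, unique up to scalar, again
-- represented by the normalised a.

module PG (F : Field) where
  open Field F

  dot : ∀ {m} → Vec Carrier m → Vec Carrier m → Carrier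
  dot [] [] = 0#
  dot (x ∷ xs) (y ∷ ys) = (x * y) + dot xs ys

  Normalized : ∀ {m} → Vec Carrier m → Set
  Normalized [] = ⊥
  Normalized (x ∷ xs) = x ≡ 1# ⊎ (x ≡ 0# × Normalized xs)

  NVec : ℕ → Set
  NVec n = Σ (Vec Carrier (suc n)) Normalized

  Point Hyperplane : ℕ → Set
  Point = NVec
  Hyperplane = NVec

  Incident : ∀ {n} → Point n → Hyperplane n → Set
  Incident (x , _) (a , _) = dot a x ≡ 0#

  IVertex : ℕ → Set
  IVertex n = Point n ⊎ Hyperplane n

  IAdj : ∀ {n} → IVertex n → IVertex n → Set
  IAdj (inj₁ p) (inj₂ h) = Incident p h
  IAdj (inj₂ h) (inj₁ p) = Incident p h
  IAdj (inj₁ _) (inj₁ _) = ⊥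
  IAdj (inj₂ _) (inj₂ _) = ⊥

  IAdj-sym : ∀ {n} {u v : IVertex n} → IAdj u v → IAdj v u
  IAdj-sym {u = inj₁ p} {inj₂ h} i = i
  IAdj-sym {u = inj₂ h} {inj₁ p} i = i

  IAdj-irrefl : ∀ {n} {v : IVertex n} → ¬ IAdj v v
  IAdj-irrefl {v = inj₁ _} ()
  IAdj-irrefl {v = inj₂ _} ()

  IncidenceGraph : ℕ → Graph
  IncidenceGraph n = record
    { V = IVertex n ; Adj = IAdj ; sym = IAdj-sym ; irrefl = λ {v} → IAdj-irrefl {v = v} }

{-# OPTIONS --safe #-}
module Submission where

-- Counting the solutions
-- of one, resp. two independent, homogeneous linear equations over F^(n+1) and dividing out the
-- q - 1 nonzero scalars shows that every vertex has θ n neighbours and that two points (or two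
-- hyperplanes) have θ (n - 1) common neighbours, where θ m = (q^m - 1)/(q - 1). In a regular graph
-- the 4-cycles through an edge uv correspond to the pairs (x, y) with x ≠ u a neighbour of v and
-- y ≠ v a common neighbour of x and u, so every edge lies on (θ n - 1)(θ (n - 1) - 1) of them.
-- For extremality fix a vertex u of a bipartite egr(N, k, 4, λ) and let c x be the number of common
-- neighbours of u and x ≠ u. Double counting gives Σ c = k(k - 1) and Σ c² = kλ + k(k - 1), and
-- c vanishes off the side of u; so Σ (c x - t)² ≥ 0 over that side, with t = q + 1, forces it to
-- have at least kq + 1 = θ 4 vertices when k = θ 3 and λ = q²(q + 1).

open import Defs
open import Data.Nat using (ℕ; suc; _+_; _*_; _∸_; _^_; _≤_)
open import Data.Nat.DivMod using (_/_)
open import Data.Unit using (⊤)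
open import Data.Product using (_×_)
open import Relation.Binary.PropositionalEquality using (_≡_)
open import Data.List using (List)
open import Data.List.Membership.Propositional using (_∈_)
open import Data.List.Relation.Unary.Unique.Propositional using (Unique)
open import Relation.Binary.Definitions using (DecidableEquality)
open import Relation.Nullary using (Dec)

module FiniteSum where
  open import Data.Nat using (ℕ; zero; suc; _+_; _*_; _≤_; _<_; z≤n; s≤s)
  open import Data.Nat.Properties
    using (+-assoc; +-comm; +-identityʳ; *-zeroʳ; *-identityˡ; *-identityʳ; *-comm; *-distribˡ-+; *-distribʳ-+;
           +-mono-≤; +-commutativeSemigroup)
  open import Data.List using (List; []; _∷_; _++_; map; length; filter; cartesianProductWith)
  open import Data.List.Membership.Propositional using (_∈_)
  open import Data.List.Membership.Propositional.Properties using (∈-filter⁺; ∈-filter⁻)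
  open import Data.List.Membership.Propositional.Properties.WithK using (unique∧set⇒bag)
  open import Data.List.Relation.Unary.Any using (here; there)
  import Data.List.Relation.Unary.All as All
  open import Data.List.Relation.Unary.Unique.Propositional using (Unique; _∷_)
  import Data.List.Relation.Unary.Unique.Propositional.Properties as Unique
  open import Data.List.Relation.Binary.Permutation.Propositional as ↭ using (_↭_)
  open import Data.List.Relation.Binary.Permutation.Propositional.Properties using (↭-length)
  open import Data.List.Relation.Binary.BagAndSetEquality using (∼bag⇒↭)
  open import Data.Product using (∃; _×_; _,_; proj₂)
  open import Data.Empty using (⊥-elim)
  open import Function.Bundles using (mk⇔)
  open import Relation.Nullary using (Dec; yes; no; ¬_)
  open import Relation.Nullary.Decidable using (¬?; _×-dec_)
  open import Relation.Unary using (Decidable)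
  open import Relation.Binary.Definitions using (DecidableEquality)
  open import Relation.Binary.PropositionalEquality using (_≡_; _≢_; refl; sym; trans; cong; cong₂; subst; module ≡-Reasoning)
  open import Algebra.Properties.CommutativeSemigroup +-commutativeSemigroup using (interchange)

  ∑ : {A : Set} → List A → (A → ℕ) → ℕ
  ∑ []       f = 0
  ∑ (x ∷ xs) f = f x + ∑ xs f

  syntax ∑ xs (λ x → e) = ∑[ x ∈ xs ] e

  χ : ∀ {p} {P : Set p} → Dec P → ℕ
  χ (yes _) = 1
  χ (no _)  = 0

  module _ {A : Set} where

    ∑-cong : ∀ xs {f g : A → ℕ} → (∀ x → f x ≡ g x) → ∑ xs f ≡ ∑ xs g
    ∑-cong []       e = refl
    ∑-cong (x ∷ xs) e = cong₂ _+_ (e x) (∑-cong xs e)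

    ∑-cong-∈ : ∀ xs {f g : A → ℕ} → (∀ x → x ∈ xs → f x ≡ g x) → ∑ xs f ≡ ∑ xs g
    ∑-cong-∈ []       e = refl
    ∑-cong-∈ (x ∷ xs) e = cong₂ _+_ (e x (here refl)) (∑-cong-∈ xs (λ y y∈ → e y (there y∈)))

    ∑-++ : ∀ xs ys (f : A → ℕ) → ∑ (xs ++ ys) f ≡ ∑ xs f + ∑ ys f
    ∑-++ []       ys f = refl
    ∑-++ (x ∷ xs) ys f = trans (cong (f x +_) (∑-++ xs ys f)) (sym (+-assoc (f x) _ _))

    ∑-↭ : ∀ {xs ys} (f : A → ℕ) → xs ↭ ys → ∑ xs f ≡ ∑ ys f
    ∑-↭ f ↭.refl                 = refl
    ∑-↭ f (↭.prep x p)           = cong (f x +_) (∑-↭ f p)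
    ∑-↭ f (↭.swap {xs} x y p)    =
      trans (sym (+-assoc (f x) (f y) _)) (trans (cong (_+ ∑ xs f) (+-comm (f x) (f y)))
      (trans (+-assoc (f y) (f x) _) (cong (λ s → f y + (f x + s)) (∑-↭ f p))))
    ∑-↭ f (↭.trans p q)          = trans (∑-↭ f p) (∑-↭ f q)

    ∑-distrib-+ : ∀ xs (f g : A → ℕ) → ∑[ x ∈ xs ] (f x + g x) ≡ ∑ xs f + ∑ xs g
    ∑-distrib-+ []       f g = refl
    ∑-distrib-+ (x ∷ xs) f g =
      trans (cong (f x + g x +_) (∑-distrib-+ xs f g)) (interchange (f x) (g x) (∑ xs f) (∑ xs g))

    ∑-*ˡ : ∀ xs c (f : A → ℕ) → ∑[ x ∈ xs ] (c * f x) ≡ c * ∑ xs f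
    ∑-*ˡ []       c f = sym (*-zeroʳ c)
    ∑-*ˡ (x ∷ xs) c f = trans (cong (c * f x +_) (∑-*ˡ xs c f)) (sym (*-distribˡ-+ c (f x) (∑ xs f)))

    ∑-*ʳ : ∀ xs c (f : A → ℕ) → ∑[ x ∈ xs ] (f x * c) ≡ ∑ xs f * c
    ∑-*ʳ xs c f = trans (∑-cong xs (λ x → *-comm (f x) c)) (trans (∑-*ˡ xs c f) (*-comm c _))

    ∑-const : ∀ (xs : List A) c → ∑[ _ ∈ xs ] c ≡ length xs * c
    ∑-const []       c = refl
    ∑-const (x ∷ xs) c = cong (c +_) (∑-const xs c)

    ∑-zero : ∀ (xs : List A) → ∑[ _ ∈ xs ] 0 ≡ 0
    ∑-zero []       = refl
    ∑-zero (x ∷ xs) = ∑-zero xs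

    ∑-vanish : ∀ xs {f : A → ℕ} → (∀ x → x ∈ xs → f x ≡ 0) → ∑ xs f ≡ 0
    ∑-vanish xs e = trans (∑-cong-∈ xs {g = λ _ → 0} e) (∑-zero xs)

    ∑-mono-≤ : ∀ xs {f g : A → ℕ} → (∀ x → f x ≤ g x) → ∑ xs f ≤ ∑ xs g
    ∑-mono-≤ []       e = z≤n
    ∑-mono-≤ (x ∷ xs) e = +-mono-≤ (e x) (∑-mono-≤ xs e)

    ∑-pos⇒∃ : ∀ xs (f : A → ℕ) → 0 < ∑ xs f → ∃ λ x → x ∈ xs × 0 < f x
    ∑-pos⇒∃ (x ∷ xs) f pos with f x in fx
    ... | suc _ = x , here refl , subst (0 <_) (sym fx) (s≤s z≤n)
    ... | zero  = let (y , y∈ , fy) = ∑-pos⇒∃ xs f pos in y , there y∈ , fy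

    ∑-single : ∀ {xs y} (f : A → ℕ) → Unique xs → y ∈ xs → (∀ x → x ≢ y → f x ≡ 0) → ∑ xs f ≡ f y
    ∑-single {y ∷ xs} f (y∉xs ∷ _) (here refl) h =
      trans (cong (f y +_) (∑-vanish xs (λ x x∈ → h x (λ { refl → All.lookup y∉xs x∈ refl })))) (+-identityʳ (f y))
    ∑-single {x ∷ xs} f (x∉xs ∷ u) (there y∈) h =
      trans (cong (_+ ∑ xs f) (h x (λ { refl → All.lookup x∉xs y∈ refl }))) (∑-single f u y∈ h)

    ∑-enumeration : ∀ {xs ys} (f : A → ℕ) → Unique xs → Unique ys →
                    (∀ x → x ∈ xs → x ∈ ys) → (∀ x → x ∈ ys → x ∈ xs) → ∑ xs f ≡ ∑ ys f
    ∑-enumeration f uxs uys xs⊆ys ys⊆xs =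
      ∑-↭ f (∼bag⇒↭ (unique∧set⇒bag uxs uys (mk⇔ (xs⊆ys _) (ys⊆xs _))))

  module _ {A B : Set} where

    ∑-map : ∀ (g : A → B) xs (f : B → ℕ) → ∑ (map g xs) f ≡ ∑ xs (λ x → f (g x))
    ∑-map g []       f = refl
    ∑-map g (x ∷ xs) f = cong (f (g x) +_) (∑-map g xs f)

    ∑-comm : ∀ (xs : List A) (ys : List B) (f : A → B → ℕ) →
             ∑[ x ∈ xs ] ∑[ y ∈ ys ] f x y ≡ ∑[ y ∈ ys ] ∑[ x ∈ xs ] f x y
    ∑-comm []       ys f = sym (∑-zero ys)
    ∑-comm (x ∷ xs) ys f =
      trans (cong (∑ ys (f x) +_) (∑-comm xs ys f)) (sym (∑-distrib-+ ys (f x) (λ y → ∑[ x ∈ xs ] f x y)))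

  ∑-cartesianProductWith : ∀ {A B C : Set} (h : A → B → C) xs ys (f : C → ℕ) →
                           ∑ (cartesianProductWith h xs ys) f ≡ ∑[ x ∈ xs ] ∑[ y ∈ ys ] f (h x y)
  ∑-cartesianProductWith h []       ys f = refl
  ∑-cartesianProductWith h (x ∷ xs) ys f =
    trans (∑-++ (map (h x) ys) _ f) (cong₂ _+_ (∑-map (h x) ys f) (∑-cartesianProductWith h xs ys f))

  module _ {p q} {P : Set p} {Q : Set q} where

    χ-cong : (P → Q) → (Q → P) → (d : Dec P) (e : Dec Q) → χ d ≡ χ e
    χ-cong f g (yes p) (yes q) = refl
    χ-cong f g (yes p) (no ¬q) = ⊥-elim (¬q (f p))
    χ-cong f g (no ¬p) (yes q) = ⊥-elim (¬p (g q))
    χ-cong f g (no ¬p) (no ¬q) = refl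

    χ-× : (d : Dec P) (e : Dec Q) → χ (d ×-dec e) ≡ χ d * χ e
    χ-× (yes _) (yes _) = refl
    χ-× (yes _) (no _)  = refl
    χ-× (no _)  _       = refl

  module _ {p} {P : Set p} where

    χ-yes : (d : Dec P) → P → χ d ≡ 1
    χ-yes (yes _) _ = refl
    χ-yes (no ¬p) p = ⊥-elim (¬p p)

    χ-no : (d : Dec P) → ¬ P → χ d ≡ 0
    χ-no (yes p) ¬p = ⊥-elim (¬p p)
    χ-no (no _)  _  = refl

    χ-pos : (d : Dec P) → 0 < χ d → P
    χ-pos (yes p) _ = p

    χ-idem : (d : Dec P) → χ d * χ d ≡ χ d
    χ-idem (yes _) = refl
    χ-idem (no _)  = refl

    χ-+-χ¬ : (d : Dec P) → χ d + χ (¬? d) ≡ 1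
    χ-+-χ¬ (yes _) = refl
    χ-+-χ¬ (no _)  = refl

  module _ {A : Set} where

    hasCount-unique : ∀ {P : A → Set} {k k'} → HasCount P k → HasCount P k' → k ≡ k'
    hasCount-unique (xs , uxs , xs⇒P , P⇒xs , refl) (ys , uys , ys⇒P , P⇒ys , refl) =
      ↭-length (∼bag⇒↭ (unique∧set⇒bag uxs uys
        (mk⇔ (λ x∈ → P⇒ys _ (xs⇒P _ x∈)) (λ y∈ → P⇒xs _ (ys⇒P _ y∈)))))

    length-filter : ∀ {P : A → Set} (P? : Decidable P) xs → length (filter P? xs) ≡ ∑[ x ∈ xs ] χ (P? x)
    length-filter P? []       = refl
    length-filter P? (x ∷ xs) with P? x
    ... | yes _ = cong suc (length-filter P? xs)
    ... | no _  = length-filter P? xs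

    hasCount-∑χ : ∀ {P : A → Set} xs → Unique xs → (∀ x → P x → x ∈ xs) → (P? : Decidable P) →
                  HasCount P (∑[ x ∈ xs ] χ (P? x))
    hasCount-∑χ xs u P⇒xs P? =
      filter P? xs , Unique.filter⁺ P? u , (λ x x∈ → proj₂ (∈-filter⁻ P? {xs = xs} x∈)) ,
      (λ x px → ∈-filter⁺ P? (P⇒xs x px) px) , length-filter P? xs

    ∑χ-hasCount : ∀ {P : A → Set} xs → Unique xs → (∀ x → x ∈ xs) → (P? : Decidable P) →
                  ∀ {k} → HasCount P k → ∑[ x ∈ xs ] χ (P? x) ≡ k
    ∑χ-hasCount xs u complete P? = hasCount-unique (hasCount-∑χ xs u (λ x _ → complete x) P?)

    ∑-split : (_≟_ : DecidableEquality A) → ∀ {xs y} (f : A → ℕ) → Unique xs → y ∈ xs →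
              ∑ xs f ≡ f y + ∑[ x ∈ xs ] (χ (¬? (x ≟ y)) * f x)
    ∑-split _≟_ {xs} {y} f u y∈ = begin
        ∑ xs f
      ≡⟨ ∑-cong xs (λ x → sym (trans (sym (*-distribʳ-+ (f x) (χ (x ≟ y)) _))
                                    (trans (cong (_* f x) (χ-+-χ¬ (x ≟ y))) (*-identityˡ (f x))))) ⟩
        ∑[ x ∈ xs ] (χ (x ≟ y) * f x + χ (¬? (x ≟ y)) * f x)
      ≡⟨ ∑-distrib-+ xs _ _ ⟩
        ∑[ x ∈ xs ] (χ (x ≟ y) * f x) + rest
      ≡⟨ cong (_+ rest) (∑-single (λ x → χ (x ≟ y) * f x) u y∈ (λ x x≢y → cong (_* f x) (χ-no (x ≟ y) x≢y))) ⟩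
        χ (y ≟ y) * f y + rest
      ≡⟨ cong (λ c → c * f y + rest) (χ-yes (y ≟ y) refl) ⟩
        f y + 0 + rest
      ≡⟨ cong (_+ rest) (+-identityʳ (f y)) ⟩
        f y + rest
      ∎
      where
      open ≡-Reasoning
      rest : ℕ
      rest = ∑[ x ∈ xs ] (χ (¬? (x ≟ y)) * f x)

  hasCount-pos⇒∃ : ∀ {A : Set} {P : A → Set} {k} → HasCount P k → 0 < k → ∃ P
  hasCount-pos⇒∃ (x ∷ _ , _ , xs⇒P , _ , _) _ = x , xs⇒P x (here refl)
  hasCount-pos⇒∃ ([] , _ , _ , _ , refl) ()

module FourCycles (G : Graph) (_≟_ : DecidableEquality (Graph.V G))
                  (Adj? : ∀ u v → Dec (Graph.Adj G u v))
                  (vs : List (Graph.V G)) (vs-unique : Unique vs) (∈-vs : ∀ x → x ∈ vs) where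
  open import Data.Nat using (ℕ; suc; _+_; _*_; z≤n; s≤s)
  open import Data.Nat.Properties using (*-identityˡ; *-identityʳ; *-zeroʳ; *-comm; *-distribˡ-+; +-comm; suc-injective; +-cancelʳ-≡)
  open import Data.Nat.Tactic.RingSolver using (solve-∀)
  open import Data.List using ([]; _∷_; cartesianProductWith)
  open import Data.List.Membership.Propositional.Properties using (∈-cartesianProductWith⁺)
  open import Data.List.Relation.Unary.All using ([]; _∷_)
  open import Data.List.Relation.Unary.AllPairs using ([]; _∷_)
  open import Data.List.Relation.Unary.Linked using ([-]; _∷_)
  import Data.List.Relation.Unary.Unique.Propositional.Properties as Unique
  open import Data.Product using (_×_; _,_; proj₂)
  open import Relation.Nullary using (yes; no)
  open import Relation.Nullary.Decidable using (¬?; _×-dec_; map′)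
  open import Relation.Binary.PropositionalEquality using (_≡_; _≢_; refl; sym; trans; cong; cong₂; subst; module ≡-Reasoning)
  open FiniteSum

  open Graph G using (V; Adj; irrefl) renaming (sym to adj-sym)

  A : V → V → ℕ
  A u v = χ (Adj? u v)

  A-sym : ∀ u v → A u v ≡ A v u
  A-sym u v = χ-cong adj-sym adj-sym (Adj? u v) (Adj? v u)

  χ≢ : V → V → ℕ
  χ≢ u x = χ (¬? (x ≟ u))

  commonNeighbours : V → V → ℕ
  commonNeighbours x u = ∑[ y ∈ vs ] (A x y * A y u)

  degree≡ : ∀ {k} v → HasCount (Adj v) k → ∑ vs (A v) ≡ k
  degree≡ v = ∑χ-hasCount vs vs-unique ∈-vs (Adj? v)

  FourPath : V → V → V → V → Set
  FourPath u v x y = x ≢ u × y ≢ v × Adj v x × Adj x y × Adj y u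

  fourPath? : ∀ u v x y → Dec (FourPath u v x y)
  fourPath? u v x y = ¬? (x ≟ u) ×-dec ¬? (y ≟ v) ×-dec Adj? v x ×-dec Adj? x y ×-dec Adj? y u

  fourPathχ : V → V → V → V → ℕ
  fourPathχ u v x y = χ≢ u x * (χ≢ v y * (A v x * (A x y * A y u)))

  χ-fourPath : ∀ u v x y → χ (fourPath? u v x y) ≡ fourPathχ u v x y
  χ-fourPath u v x y =
    trans (χ-× (¬? (x ≟ u)) _) (cong (χ≢ u x *_) (trans (χ-× (¬? (y ≟ v)) _) (cong (χ≢ v y *_)
    (trans (χ-× (Adj? v x) _) (cong (A v x *_) (χ-× (Adj? x y) (Adj? y u)))))))

  fourCycles : V → V → ℕ
  fourCycles u v = ∑[ x ∈ vs ] ∑[ y ∈ vs ] fourPathχ u v x y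

  adj⇒≢ : ∀ {a b} → Adj a b → a ≢ b
  adj⇒≢ ab refl = irrefl ab

  module _ {u v : V} (uv : Adj u v) where

    fourPath⇒cycle : ∀ {a b x y} → a ≡ u × b ≡ v × FourPath u v x y →
                     CycleThrough G u v 4 (a ∷ b ∷ x ∷ y ∷ [])
    fourPath⇒cycle (refl , refl , x≢u , y≢v , vx , xy , yu) =
      (s≤s (s≤s (s≤s z≤n)) ,
       (adj⇒≢ uv ∷ (λ u≡x → x≢u (sym u≡x)) ∷ (λ u≡y → adj⇒≢ yu (sym u≡y)) ∷ []) ∷
       (adj⇒≢ vx ∷ (λ v≡y → y≢v (sym v≡y)) ∷ []) ∷
       (adj⇒≢ xy ∷ []) ∷ [] ∷ [] ,
       uv ∷ vx ∷ xy ∷ yu ∷ [-]) ,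
      refl , _ , refl

    cycle⇒fourPath : ∀ {a b x y} → CycleThrough G u v 4 (a ∷ b ∷ x ∷ y ∷ []) →
                     a ≡ u × b ≡ v × FourPath u v x y
    cycle⇒fourPath ((_ , (_ ∷ u≢x ∷ _) ∷ (_ ∷ v≢y ∷ _) ∷ _ , _ ∷ vx ∷ xy ∷ yu ∷ [-]) , _ , _ , refl) =
      refl , refl , (λ x≡u → u≢x (sym x≡u)) , (λ y≡v → v≢y (sym y≡v)) , vx , xy , yu

    cycleThrough? : ∀ c → Dec (CycleThrough G u v 4 c)
    cycleThrough? (a ∷ b ∷ x ∷ y ∷ []) =
      map′ fourPath⇒cycle cycle⇒fourPath ((a ≟ u) ×-dec (b ≟ v) ×-dec fourPath? u v x y)
    cycleThrough? []                    = no λ { (_ , _ , _ , ()) }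
    cycleThrough? (_ ∷ [])              = no λ { (_ , () , _) }
    cycleThrough? (_ ∷ _ ∷ [])          = no λ { (_ , () , _) }
    cycleThrough? (_ ∷ _ ∷ _ ∷ [])      = no λ { (_ , () , _) }
    cycleThrough? (_ ∷ _ ∷ _ ∷ _ ∷ _ ∷ _) = no λ { (_ , () , _) }

    hasCount-fourCycles : HasCount (CycleThrough G u v 4) (fourCycles u v)
    hasCount-fourCycles =
      subst (HasCount (CycleThrough G u v 4)) count
        (hasCount-∑χ candidates (Unique.cartesianProductWith⁺ _ (λ { refl → refl , refl }) vs-unique vs-unique)
                     candidate cycleThrough?)
      where
      candidates : List (List V)
      candidates = cartesianProductWith (λ x y → u ∷ v ∷ x ∷ y ∷ []) vs vs

      candidate : ∀ c → CycleThrough G u v 4 c → c ∈ candidates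
      candidate (a ∷ b ∷ x ∷ y ∷ []) cyc with cycle⇒fourPath cyc
      ... | refl , refl , _ = ∈-cartesianProductWith⁺ _ (∈-vs x) (∈-vs y)
      candidate []                    (_ , _ , _ , ())
      candidate (_ ∷ [])              (_ , () , _)
      candidate (_ ∷ _ ∷ [])          (_ , () , _)
      candidate (_ ∷ _ ∷ _ ∷ [])      (_ , () , _)
      candidate (_ ∷ _ ∷ _ ∷ _ ∷ _ ∷ _) (_ , () , _)

      count : ∑ candidates (λ c → χ (cycleThrough? c)) ≡ fourCycles u v
      count = trans (∑-cartesianProductWith _ vs vs _) (∑-cong vs λ x → ∑-cong vs λ y →
        trans (χ-cong (λ cyc → proj₂ (proj₂ (cycle⇒fourPath cyc))) (λ p → fourPath⇒cycle (refl , refl , p))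
                      (cycleThrough? (u ∷ v ∷ x ∷ y ∷ [])) (fourPath? u v x y))
              (χ-fourPath u v x y))

    otherNeighbours : ∀ {d} → ∑ vs (A v) ≡ suc d → ∑[ x ∈ vs ] (χ≢ u x * A v x) ≡ d
    otherNeighbours deg = suc-injective (begin
        suc (∑[ x ∈ vs ] (χ≢ u x * A v x))
      ≡⟨ cong (_+ ∑[ x ∈ vs ] (χ≢ u x * A v x)) (χ-yes (Adj? v u) (adj-sym uv)) ⟨
        A v u + ∑[ x ∈ vs ] (χ≢ u x * A v x)
      ≡⟨ ∑-split _≟_ (A v) vs-unique (∈-vs u) ⟨
        ∑ vs (A v)
      ≡⟨ deg ⟩
        suc _
      ∎)
      where open ≡-Reasoning

    -- Among the common neighbours y of u and a neighbour x ≠ u of v, exactly y = v closes no 4-cycle.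
    fourCycles+otherNeighbours :
      fourCycles u v + ∑[ x ∈ vs ] (χ≢ u x * A v x) ≡ ∑[ x ∈ vs ] (χ≢ u x * (A v x * commonNeighbours x u))
    fourCycles+otherNeighbours =
      trans (sym (∑-distrib-+ vs _ _)) (∑-cong vs through)
      where
      through : ∀ x → ∑[ y ∈ vs ] fourPathχ u v x y + χ≢ u x * A v x ≡ χ≢ u x * (A v x * commonNeighbours x u)
      through x = begin
          ∑[ y ∈ vs ] fourPathχ u v x y + n * a
        ≡⟨ cong (_+ n * a) (trans (∑-cong vs (λ y → regroup n (χ≢ v y) a (A x y) (A y u))) (∑-*ˡ vs (n * a) _)) ⟩
          n * a * T + n * a
        ≡⟨ expand n a T ⟩
          n * (a + a * T)
        ≡⟨ cong (λ z → n * (z + a * T)) (χ-idem (Adj? v x)) ⟨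
          n * (a * a + a * T)
        ≡⟨ cong (n *_) (*-distribˡ-+ a a T) ⟨
          n * (a * (a + T))
        ≡⟨ cong (λ z → n * (a * (z + T))) a≡path ⟩
          n * (a * (A x v * A v u + T))
        ≡⟨ cong (λ z → n * (a * z)) (∑-split _≟_ (λ y → A x y * A y u) vs-unique (∈-vs v)) ⟨
          n * (a * commonNeighbours x u)
        ∎
        where
        open ≡-Reasoning
        n a T : ℕ
        n = χ≢ u x
        a = A v x
        T = ∑[ y ∈ vs ] (χ≢ v y * (A x y * A y u))
        a≡path : a ≡ A x v * A v u
        a≡path = trans (sym (*-identityʳ a)) (cong₂ _*_ (A-sym v x) (sym (χ-yes (Adj? v u) (adj-sym uv))))
        regroup : ∀ n m a b c → n * (m * (a * (b * c))) ≡ n * a * (m * (b * c))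
        regroup = solve-∀
        expand : ∀ n a T → n * a * T + n * a ≡ n * (a + a * T)
        expand = solve-∀

    fourCycles-constant : ∀ c d → ∑ vs (A v) ≡ suc d →
                          (∀ x → x ≢ u → Adj v x → commonNeighbours x u ≡ suc c) →
                          fourCycles u v ≡ c * d
    fourCycles-constant c d deg common = +-cancelʳ-≡ d _ _ (begin
        fourCycles u v + d
      ≡⟨ cong (fourCycles u v +_) (otherNeighbours deg) ⟨
        fourCycles u v + ∑[ x ∈ vs ] (χ≢ u x * A v x)
      ≡⟨ fourCycles+otherNeighbours ⟩
        ∑[ x ∈ vs ] (χ≢ u x * (A v x * commonNeighbours x u))
      ≡⟨ ∑-cong vs constant ⟩
        ∑[ x ∈ vs ] (suc c * (χ≢ u x * A v x))
      ≡⟨ ∑-*ˡ vs (suc c) _ ⟩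
        suc c * ∑[ x ∈ vs ] (χ≢ u x * A v x)
      ≡⟨ cong (suc c *_) (otherNeighbours deg) ⟩
        suc c * d
      ≡⟨ +-comm d (c * d) ⟩
        c * d + d
      ∎)
      where
      open ≡-Reasoning
      constant : ∀ x → χ≢ u x * (A v x * commonNeighbours x u) ≡ suc c * (χ≢ u x * A v x)
      constant x with x ≟ u | Adj? v x
      ... | yes _  | _      = sym (*-zeroʳ (suc c))
      ... | no _   | no _   = sym (*-zeroʳ (suc c))
      ... | no x≢u | yes vx = trans (*-identityˡ _) (trans (*-identityˡ _) (trans (common x x≢u vx) (sym (*-identityʳ (suc c)))))

  module Regular (k λ' : ℕ) (degree : ∀ v → ∑ vs (A v) ≡ suc k) (cycles : ∀ u v → Adj u v → fourCycles u v ≡ λ') where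

    ∑-commonNeighbours : ∀ u → ∑[ x ∈ vs ] (χ≢ u x * commonNeighbours x u) ≡ suc k * k
    ∑-commonNeighbours u = begin
        ∑[ x ∈ vs ] (χ≢ u x * commonNeighbours x u)
      ≡⟨ ∑-cong vs (λ x → trans (sym (∑-*ˡ vs (χ≢ u x) _)) (∑-cong vs (λ y →
           trans (cong (λ a → χ≢ u x * (a * A y u)) (A-sym x y)) (regroup (χ≢ u x) (A y x) (A y u))))) ⟩
        ∑[ x ∈ vs ] ∑[ y ∈ vs ] (A y u * (χ≢ u x * A y x))
      ≡⟨ ∑-comm vs vs _ ⟩
        ∑[ y ∈ vs ] ∑[ x ∈ vs ] (A y u * (χ≢ u x * A y x))
      ≡⟨ ∑-cong vs (λ y → trans (∑-*ˡ vs (A y u) _) (viaNeighbour y (Adj? y u))) ⟩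
        ∑[ y ∈ vs ] (A y u * k)
      ≡⟨ ∑-*ʳ vs k _ ⟩
        ∑[ y ∈ vs ] A y u * k
      ≡⟨ cong (_* k) (trans (∑-cong vs (λ y → A-sym y u)) (degree u)) ⟩
        suc k * k
      ∎
      where
      open ≡-Reasoning
      regroup : ∀ n a b → n * (a * b) ≡ b * (n * a)
      regroup = solve-∀
      viaNeighbour : ∀ y (d : Dec (Adj y u)) → χ d * ∑[ x ∈ vs ] (χ≢ u x * A y x) ≡ χ d * k
      viaNeighbour y (yes yu) = cong (1 *_) (otherNeighbours (adj-sym yu) (degree y))
      viaNeighbour y (no _)   = refl

    -- Summing fourCycles+otherNeighbours over the neighbours y of u counts pairs of paths u ~ y ~ x, x ≠ u.
    ∑-commonNeighbours² : ∀ u → ∑[ x ∈ vs ] (χ≢ u x * (commonNeighbours x u * commonNeighbours x u)) ≡ suc k * λ' + suc k * k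
    ∑-commonNeighbours² u = sym (begin
        suc k * λ' + suc k * k
      ≡⟨ *-distribˡ-+ (suc k) λ' k ⟨
        suc k * (λ' + k)
      ≡⟨ cong (_* (λ' + k)) (degree u) ⟨
        ∑ vs (A u) * (λ' + k)
      ≡⟨ ∑-*ʳ vs (λ' + k) (A u) ⟨
        ∑[ y ∈ vs ] (A u y * (λ' + k))
      ≡⟨ ∑-cong vs (λ y → viaNeighbour y (Adj? u y)) ⟩
        ∑[ y ∈ vs ] (A u y * ∑[ x ∈ vs ] (χ≢ u x * (A y x * c x)))
      ≡⟨ ∑-cong vs (λ y → trans (sym (∑-*ˡ vs (A u y) _)) (∑-cong vs (λ x → regroup (A u y) (χ≢ u x) (A y x) (c x)))) ⟩
        ∑[ y ∈ vs ] ∑[ x ∈ vs ] (χ≢ u x * (c x * (A u y * A y x)))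
      ≡⟨ ∑-comm vs vs _ ⟩
        ∑[ x ∈ vs ] ∑[ y ∈ vs ] (χ≢ u x * (c x * (A u y * A y x)))
      ≡⟨ ∑-cong vs (λ x → trans (∑-*ˡ vs (χ≢ u x) _) (cong (χ≢ u x *_) (trans (∑-*ˡ vs (c x) _)
           (cong (c x *_) (∑-cong vs (λ y → reverse x y))))))  ⟩
        ∑[ x ∈ vs ] (χ≢ u x * (c x * c x))
      ∎)
      where
      open ≡-Reasoning
      c : V → ℕ
      c x = commonNeighbours x u
      regroup : ∀ a n b d → a * (n * (b * d)) ≡ n * (d * (a * b))
      regroup = solve-∀
      reverse : ∀ x y → A u y * A y x ≡ A x y * A y u
      reverse x y = trans (*-comm (A u y) (A y x)) (cong₂ _*_ (A-sym y x) (A-sym u y))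
      viaNeighbour : ∀ y (d : Dec (Adj u y)) → χ d * (λ' + k) ≡ χ d * ∑[ x ∈ vs ] (χ≢ u x * (A y x * c x))
      viaNeighbour y (yes uy) = cong (1 *_) (begin
          λ' + k
        ≡⟨ cong₂ _+_ (cycles u y uy) (otherNeighbours uy (degree y)) ⟨
          fourCycles u y + ∑[ x ∈ vs ] (χ≢ u x * A y x)
        ≡⟨ fourCycles+otherNeighbours uy ⟩
          ∑[ x ∈ vs ] (χ≢ u x * (A y x * c x))
        ∎)
      viaNeighbour y (no _) = refl

module ExtremalBound where
  open import Data.Nat using (ℕ; suc; _+_; _*_; _≤_; _<_; _≤?_; z≤n; s≤s)
  open import Data.Nat.Properties
    using (≤-total; m≤n⇒∃[o]m+o≡n; m≤m+n; +-mono-≤; +-cancelˡ-≤; *-cancelˡ-≤; *-monoʳ-≤;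
           *-comm; *-identityʳ; *-distribˡ-+; *-zeroʳ; +-identityʳ)
  open import Data.Nat.Tactic.RingSolver using (solve-∀)
  open import Data.Bool using (Bool)
  import Data.Bool as Bool
  open import Data.Bool.Properties using (¬-not)
  open import Data.List using (List; []; _∷_; length)
  open import Data.List.Membership.Propositional using (_∈_)
  open import Data.List.Membership.DecPropositional using (_∈?_)
  open import Data.List.Relation.Unary.Any using (here; there)
  open import Data.List.Relation.Unary.Unique.Propositional using (Unique)
  open import Data.Product using (_,_)
  open import Data.Sum using (inj₁; inj₂)
  open import Data.Unit using (tt)
  open import Data.Empty using (⊥-elim)
  open import Relation.Nullary using (Dec; yes; no; ¬_)
  open import Relation.Nullary.Decidable using (map′; decidable-stable; ¬¬-excluded-middle)
  open import Relation.Binary.Definitions using (DecidableEquality)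
  open import Relation.Binary.PropositionalEquality
    using (_≡_; _≢_; refl; sym; trans; cong; cong₂; subst; subst₂; module ≡-Reasoning)
  open FiniteSum

  ¬¬-∀∈ : ∀ {X : Set} {P : X → Set} (xs : List X) → (∀ x → ¬ ¬ P x) → ¬ ¬ (∀ x → x ∈ xs → P x)
  ¬¬-∀∈ []       ¬¬P ¬all = ¬all (λ _ ())
  ¬¬-∀∈ (y ∷ xs) ¬¬P ¬all =
    ¬¬P y (λ Py → ¬¬-∀∈ xs ¬¬P (λ all → ¬all (λ { x (here refl) → Py ; x (there x∈) → all x x∈ })))

  ¬¬-decidableEquality : ∀ {X : Set} (xs : List X) → (∀ x → x ∈ xs) → ¬ ¬ DecidableEquality X
  ¬¬-decidableEquality xs ∈-xs ¬dec =
    ¬¬-∀∈ xs (λ x → ¬¬-∀∈ xs (λ y → ¬¬-excluded-middle)) (λ dec → ¬dec (λ x y → dec x (∈-xs x) y (∈-xs y)))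

  2tc≤c²+t² : ∀ c t → 2 * t * c ≤ c * c + t * t
  2tc≤c²+t² c t with ≤-total c t
  ... | inj₁ c≤t = let d , c+d≡t = m≤n⇒∃[o]m+o≡n c≤t in
    subst (λ t → 2 * t * c ≤ c * c + t * t) c+d≡t (subst (2 * (c + d) * c ≤_) (square c d) (m≤m+n _ (d * d)))
    where
    square : ∀ c d → 2 * (c + d) * c + d * d ≡ c * c + (c + d) * (c + d)
    square = solve-∀
  ... | inj₂ t≤c = let d , t+d≡c = m≤n⇒∃[o]m+o≡n t≤c in
    subst (λ c → 2 * t * c ≤ c * c + t * t) t+d≡c (subst (2 * t * (t + d) ≤_) (square t d) (m≤m+n _ (d * d)))
    where
    square : ∀ t d → 2 * t * (t + d) + d * d ≡ (t + d) * (t + d) + t * t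
    square = solve-∀

  ∑-2tc≤c²+t² : ∀ {X : Set} (xs : List X) (s c : X → ℕ) t →
    2 * t * ∑[ x ∈ xs ] (s x * c x) ≤ ∑[ x ∈ xs ] (s x * (c x * c x)) + t * t * ∑ xs s
  ∑-2tc≤c²+t² xs s c t =
    subst₂ _≤_ left right (∑-mono-≤ xs (λ x → *-monoʳ-≤ (s x) (2tc≤c²+t² (c x) t)))
    where
    open ≡-Reasoning
    left : ∑[ x ∈ xs ] (s x * (2 * t * c x)) ≡ 2 * t * ∑[ x ∈ xs ] (s x * c x)
    left = trans (∑-cong xs (λ x → regroup t (s x) (c x))) (∑-*ˡ xs (2 * t) _)
      where
      regroup : ∀ t s c → s * (2 * t * c) ≡ 2 * t * (s * c)
      regroup = solve-∀
    right : ∑[ x ∈ xs ] (s x * (c x * c x + t * t)) ≡ ∑[ x ∈ xs ] (s x * (c x * c x)) + t * t * ∑ xs s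
    right = begin
      ∑[ x ∈ xs ] (s x * (c x * c x + t * t))                 ≡⟨ ∑-cong xs (λ x → *-distribˡ-+ (s x) _ _) ⟩
      ∑[ x ∈ xs ] (s x * (c x * c x) + s x * (t * t))         ≡⟨ ∑-distrib-+ xs _ _ ⟩
      ∑[ x ∈ xs ] (s x * (c x * c x)) + ∑[ x ∈ xs ] (s x * (t * t))
        ≡⟨ cong (∑[ x ∈ xs ] (s x * (c x * c x)) +_) (trans (∑-*ʳ xs (t * t) s) (*-comm _ (t * t))) ⟩
      ∑[ x ∈ xs ] (s x * (c x * c x)) + t * t * ∑ xs s        ∎

  -- 2t k(k - 1) ≤ k λ + k(k - 1) + t² D at k - 1 = q(q + 1), λ = q²(q + 1) and t = q + 1
  variance-bound : ∀ K q D → 2 * suc q * (K * (q * suc q)) ≤ K * (q * q * suc q) + K * (q * suc q) + suc q * suc q * D →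
                   K * q ≤ D
  variance-bound K q D le = *-cancelˡ-≤ (t * t) t²Kq≤t²D
    where
    double : ∀ K q → 2 * suc q * (K * (q * suc q)) ≡ K * q * (suc q * suc q) + K * q * (suc q * suc q)
    double = solve-∀
    single : ∀ K q → K * (q * q * suc q) + K * (q * suc q) ≡ K * q * (suc q * suc q)
    single = solve-∀
    t X : ℕ
    t = suc q
    X = K * q * (t * t)
    X+X≤X+t²D : X + X ≤ X + t * t * D
    X+X≤X+t²D = subst₂ _≤_ (double K q) (cong (_+ t * t * D) (single K q)) le
    t²Kq≤t²D : t * t * (K * q) ≤ t * t * D
    t²Kq≤t²D = subst (_≤ t * t * D) (*-comm (K * q) (t * t)) (+-cancelˡ-≤ X X _ X+X≤X+t²D)

  module SideSize (H : Graph) (_≟_ : DecidableEquality (Graph.V H))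
                  (side : Graph.V H → Bool) (bipartite : ∀ {u v} → Graph.Adj H u v → side u ≢ side v)
                  (vs : List (Graph.V H)) (vs-unique : Unique vs) (∈-vs : ∀ x → x ∈ vs)
                  (k λ' : ℕ) (#neighbours : ∀ v → HasCount (Graph.Adj H v) (suc k))
                  (#cycles : ∀ u v → Graph.Adj H u v → HasCount (CycleThrough H u v 4) λ') where

    open Graph H using (V; Adj)

    adj? : ∀ u v → Dec (Adj u v)
    adj? u v with #neighbours u
    ... | ns , _ , ns⇒adj , adj⇒ns , _ = map′ (ns⇒adj v) (adj⇒ns v) (_∈?_ _≟_ v ns)

    open FourCycles H _≟_ adj? vs vs-unique ∈-vs
    open Regular k λ' (λ v → degree≡ v (#neighbours v)) (λ u v uv → hasCount-unique (hasCount-fourCycles uv) (#cycles u v uv))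

    sameSide : V → V → ℕ
    sameSide u x = χ≢ u x * χ (side x Bool.≟ side u)

    commonNeighbours-otherSide : ∀ x u → side x ≢ side u → commonNeighbours x u ≡ 0
    commonNeighbours-otherSide x u x≁u = ∑-vanish vs (λ y _ → path y (adj? x y) (adj? y u))
      where
      path : ∀ y (d : Dec (Adj x y)) (e : Dec (Adj y u)) → χ d * χ e ≡ 0
      path y (yes xy) (yes yu) = ⊥-elim (x≁u (trans (¬-not (bipartite xy)) (sym (¬-not (λ u≡y → bipartite yu (sym u≡y))))))
      path y (yes _)  (no _)   = refl
      path y (no _)   _        = refl

    restrictToSide : ∀ u x (f : ℕ → ℕ) → f 0 ≡ 0 → χ≢ u x * f (commonNeighbours x u) ≡ sameSide u x * f (commonNeighbours x u)
    restrictToSide u x f f0≡0 with side x Bool.≟ side u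
    ... | yes _   = cong (_* f (commonNeighbours x u)) (sym (*-identityʳ (χ≢ u x)))
    ... | no x≁u  rewrite commonNeighbours-otherSide x u x≁u | f0≡0 | *-zeroʳ (χ≢ u x) = refl

    #sameSide : ∀ u → ∑[ x ∈ vs ] χ (side x Bool.≟ side u) ≡ suc (∑ vs (sameSide u))
    #sameSide u =
      trans (∑-split _≟_ _ vs-unique (∈-vs u)) (cong (_+ ∑ vs (sameSide u)) (χ-yes (side u Bool.≟ side u) refl))

    sameSide-size : ∀ q → k ≡ q * suc q → λ' ≡ q * q * suc q →
                    ∀ u → suc (suc k * q) ≤ ∑[ x ∈ vs ] χ (side x Bool.≟ side u)
    sameSide-size q refl refl u =
      subst (suc (suc k * q) ≤_) (sym (#sameSide u)) (s≤s (variance-bound (suc k) q _ amgm))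
      where
      c : V → ℕ
      c x = commonNeighbours x u
      first : ∑[ x ∈ vs ] (sameSide u x * c x) ≡ suc k * k
      first = trans (sym (∑-cong vs (λ x → restrictToSide u x (λ z → z) refl))) (∑-commonNeighbours u)
      second : ∑[ x ∈ vs ] (sameSide u x * (c x * c x)) ≡ suc k * λ' + suc k * k
      second = trans (sym (∑-cong vs (λ x → restrictToSide u x (λ z → z * z) refl))) (∑-commonNeighbours² u)
      amgm : 2 * suc q * (suc k * k) ≤ suc k * λ' + suc k * k + suc q * suc q * ∑ vs (sameSide u)
      amgm = subst₂ _≤_ (cong (2 * suc q *_) first) (cong (_+ suc q * suc q * ∑ vs (sameSide u)) second)
                    (∑-2tc≤c²+t² vs (sameSide u) c (suc q))

    χ-either : ∀ a b c → b ≢ c → χ (a Bool.≟ b) + χ (a Bool.≟ c) ≡ 1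
    χ-either a b c b≢c with a Bool.≟ b
    ... | yes refl = cong suc (χ-no (a Bool.≟ c) b≢c)
    ... | no a≢b   = χ-yes (a Bool.≟ c) (trans (¬-not a≢b) (sym (¬-not (λ c≡b → b≢c (sym c≡b)))))

    order-bound : ∀ q → k ≡ q * suc q → λ' ≡ q * q * suc q → V → 2 * suc (suc k * q) ≤ length vs
    order-bound q k≡ λ≡ u with ∑-pos⇒∃ vs (A u) (subst (0 <_) (sym (degree≡ u (#neighbours u))) (s≤s z≤n))
    ... | w , _ , uw =
      subst₂ _≤_ (cong (suc (suc k * q) +_) (sym (+-identityʳ _))) partition
             (+-mono-≤ (sameSide-size q k≡ λ≡ u) (sameSide-size q k≡ λ≡ w))
      where
      partition : ∑[ x ∈ vs ] χ (side x Bool.≟ side u) + ∑[ x ∈ vs ] χ (side x Bool.≟ side w) ≡ length vs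
      partition = trans (sym (∑-distrib-+ vs _ _))
                        (trans (∑-cong vs (λ x → χ-either (side x) (side u) (side w) (bipartite (χ-pos (adj? u w) uw))))
                               (trans (∑-const vs 1) (*-identityʳ _)))

  -- Decidable equality on the vertices of H is only available under ¬ ¬ (from the enumeration),
  -- which suffices because the goal is a decidable inequality.
  bipartiteEgr-order-bound : ∀ q (H : Graph) M → Bipartite H → IsEgr H M (suc (q * suc q)) 4 (q * q * suc q) →
                             2 * suc (suc (q * suc q) * q) ≤ M
  bipartiteEgr-order-bound q H M (side , bipartite)
                           (_ , (vs , vs-unique , _ , ∈-vs , refl) , #neighbours , ((cycle , _ , length≡4) , _) , #cycles) =
    decidable-stable (_ ≤? length vs) λ ≰ → ¬¬-decidableEquality vs complete λ _≟_ →
      ≰ (SideSize.order-bound H _≟_ side bipartite vs vs-unique complete (q * suc q) (q * q * suc q) #neighbours #cycles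
                              q refl refl (vertexOf cycle length≡4))
    where
    complete : ∀ x → x ∈ vs
    complete x = ∈-vs x tt
    vertexOf : (c : List (Graph.V H)) → length c ≡ 4 → Graph.V H
    vertexOf (u ∷ _) _ = u

module QNumber (r : ℕ) where
  open import Data.Nat using (zero; suc; _+_; _*_; _^_; _∸_; _≤_; _<_; z≤n; s≤s)
  open import Data.Nat.Properties
    using (*-zeroʳ; *-comm; *-distribˡ-+; +-comm; +-suc; *-cancelˡ-≡; suc-injective; m+n∸m≡n; ^-distribˡ-+-*)
  open import Data.Nat.DivMod using (_/_; m*n/n≡m)
  open import Data.Nat.Tactic.RingSolver using (solve-∀)
  open import Relation.Binary.PropositionalEquality using (_≡_; sym; trans; cong; cong₂; subst; module ≡-Reasoning)

  q-1 q : ℕ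
  q-1 = suc r
  q   = suc q-1

  -- θ m = q^(m-1) + … + q + 1, the q-number [m]_q; it counts the points of PG(m - 1, q)
  θ : ℕ → ℕ
  θ zero    = 0
  θ (suc m) = q ^ m + θ m

  θ-closed : ∀ m → suc (q-1 * θ m) ≡ q ^ m
  θ-closed zero    = cong suc (*-zeroʳ q-1)
  θ-closed (suc m) = begin
    suc (q-1 * (q ^ m + θ m))        ≡⟨ cong suc (*-distribˡ-+ q-1 (q ^ m) (θ m)) ⟩
    suc (q-1 * q ^ m + q-1 * θ m)    ≡⟨ +-suc (q-1 * q ^ m) (q-1 * θ m) ⟨
    q-1 * q ^ m + suc (q-1 * θ m)    ≡⟨ cong (q-1 * q ^ m +_) (θ-closed m) ⟩
    q-1 * q ^ m + q ^ m              ≡⟨ +-comm (q-1 * q ^ m) (q ^ m) ⟩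
    q ^ suc m                        ∎
    where open ≡-Reasoning

  θ-suc : ∀ m → θ (suc m) ≡ suc (q * θ m)
  θ-suc zero    = cong suc (sym (*-zeroʳ q))
  θ-suc (suc m) = begin
    q ^ suc m + θ (suc m)            ≡⟨ cong (q ^ suc m +_) (θ-suc m) ⟩
    q ^ suc m + suc (q * θ m)        ≡⟨ +-suc _ _ ⟩
    suc (q * q ^ m + q * θ m)        ≡⟨ cong suc (*-distribˡ-+ q (q ^ m) (θ m)) ⟨
    suc (q * θ (suc m))              ∎
    where open ≡-Reasoning

  θ-positive : ∀ m → 1 ≤ m → 0 < θ m
  θ-positive (suc m) _ = subst (0 <_) (sym (θ-suc m)) (s≤s z≤n)

  θ-cancel : ∀ {k} m → suc (q-1 * k) ≡ q ^ m → k ≡ θ m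
  θ-cancel {k} m e = *-cancelˡ-≡ k (θ m) q-1 (suc-injective (trans e (sym (θ-closed m))))

  θ-quotient : ∀ m → (q ^ m ∸ 1) / (q ∸ 1) ≡ θ m
  θ-quotient m = begin
    (q ^ m ∸ 1) / q-1            ≡⟨ cong (λ z → (z ∸ 1) / q-1) (θ-closed m) ⟨
    (q-1 * θ m) / q-1            ≡⟨ cong (_/ q-1) (*-comm q-1 (θ m)) ⟩
    (θ m * q-1) / q-1            ≡⟨ m*n/n≡m (θ m) q-1 ⟩
    θ m                          ∎
    where open ≡-Reasoning

  -- q^(2n-1) + q² - q^(n+1) - q^n = q (q^(n-1) - 1) (q^(n-1) - q), and both factors are multiples of q - 1
  λ-quotient : ∀ m → let n = suc (suc m) in
    ((q ^ (2 * n ∸ 1) + q ^ 2) ∸ (q ^ (n + 1) + q ^ n)) / ((q ∸ 1) * (q ∸ 1)) ≡ (q * θ m) * (q * θ (suc m))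
  λ-quotient m = begin
      ((q ^ (2 * n ∸ 1) + q ^ 2) ∸ (q ^ (n + 1) + q ^ n)) / (q-1 * q-1)
    ≡⟨ cong (λ z → z / (q-1 * q-1)) (cong₂ _∸_ (cong (_+ q ^ 2) q^[2n-1]) (cong (_+ q ^ n) q^[n+1])) ⟩
      ((q * (X * X) + q ^ 2) ∸ (q * (q * X) + q * X)) / (q-1 * q-1)
    ≡⟨ cong (λ X → ((q * (X * X) + q ^ 2) ∸ (q * (q * X) + q * X)) / (q-1 * q-1)) X≡ ⟩
      ((q * (X' * X') + q ^ 2) ∸ (q * (q * X') + q * X')) / (q-1 * q-1)
    ≡⟨ cong (λ z → (z ∸ (q * (q * X') + q * X')) / (q-1 * q-1)) (numerator q-1 (θ m)) ⟩
      (((q * (q * X') + q * X') + q-1 * q-1 * Λ) ∸ (q * (q * X') + q * X')) / (q-1 * q-1)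
    ≡⟨ cong (_/ (q-1 * q-1)) (m+n∸m≡n (q * (q * X') + q * X') (q-1 * q-1 * Λ)) ⟩
      (q-1 * q-1 * Λ) / (q-1 * q-1)
    ≡⟨ cong (_/ (q-1 * q-1)) (*-comm (q-1 * q-1) Λ) ⟩
      (Λ * (q-1 * q-1)) / (q-1 * q-1)
    ≡⟨ m*n/n≡m Λ (q-1 * q-1) ⟩
      Λ
    ≡⟨ cong (λ z → (q * θ m) * (q * z)) (θ-suc m) ⟨
      (q * θ m) * (q * θ (suc m))
    ∎
    where
    open ≡-Reasoning
    n X X' Λ : ℕ
    n  = suc (suc m)
    X  = q ^ suc m
    X' = suc (q-1 * suc (q * θ m))
    Λ  = (q * θ m) * (q * suc (q * θ m))

    q^[2n-1] : q ^ (2 * n ∸ 1) ≡ q * (X * X)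
    q^[2n-1] = trans (cong (λ e → q ^ (e ∸ 1)) (double m)) (cong (q *_) (^-distribˡ-+-* q (suc m) (suc m)))
      where
      double : ∀ m → 2 * suc (suc m) ≡ 2 + (suc m + suc m)
      double = solve-∀

    q^[n+1] : q ^ (n + 1) ≡ q * (q * X)
    q^[n+1] = cong (q ^_) (+-comm n 1)

    X≡ : X ≡ X'
    X≡ = trans (sym (θ-closed (suc m))) (cong (λ z → suc (q-1 * z)) (θ-suc m))

    numerator : ∀ a b → suc a * (suc (a * suc (suc a * b)) * suc (a * suc (suc a * b))) + suc a * (suc a * 1)
      ≡ (suc a * (suc a * suc (a * suc (suc a * b))) + suc a * suc (a * suc (suc a * b))) + a * a * ((suc a * b) * (suc a * suc (suc a * b)))
    numerator = solve-∀

module FieldVectors (F : Field) where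
  open import Data.Nat using (suc)
  open import Data.Vec using (Vec; []; _∷_; map; zipWith; replicate; head; tail)
  import Data.Vec.Properties as Vec
  open import Data.Product using (_,_; proj₁)
  open import Data.Sum using (inj₁; inj₂)
  open import Data.Empty using (⊥-elim)
  open import Relation.Nullary using (yes; no; ¬_)
  open import Relation.Binary.Definitions using (DecidableEquality)
  open import Relation.Binary.PropositionalEquality
    using (_≡_; _≢_; refl; sym; trans; cong; cong₂; subst; module ≡-Reasoning)
  open import Algebra.Bundles using (CommutativeRing)
  import Algebra.Properties.Ring as RingProperties
  import Algebra.Properties.Group as GroupProperties
  open import Axiom.UniquenessOfIdentityProofs using (module Decidable⇒UIP)

  open Field F
    renaming (_+_ to infixl 6 _⊕_; _*_ to infixl 7 _⊗_; -_ to infix 8 ⊝_; _⁻¹ to infix 9 _⁻¹; _≟_ to infix 4 _≟_)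
  open PG F using (dot; Normalized; NVec)

  ring : CommutativeRing _ _
  ring = record { isCommutativeRing = isCommutativeRing }

  open CommutativeRing ring
    using (+-assoc; +-comm; +-identityˡ; +-identityʳ; -‿inverseˡ;
           *-assoc; *-comm; *-identityˡ; *-identityʳ; zeroˡ; zeroʳ; distribˡ; distribʳ)
  open RingProperties (CommutativeRing.ring ring) using (-‿distribˡ-*; -‿distribʳ-*)
  open GroupProperties (CommutativeRing.+-group ring) using (inverseˡ-unique; ⁻¹-involutive)
  open import Algebra.Properties.CommutativeSemigroup (CommutativeRing.+-commutativeSemigroup ring) using (interchange)

  ⁻¹-inverseˡ : ∀ t → t ≢ 0# → t ⁻¹ ⊗ t ≡ 1#
  ⁻¹-inverseˡ t t≢0 = trans (*-comm (t ⁻¹) t) (⁻¹-inverse t t≢0)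

  ⁻¹-nonZero : ∀ t → t ≢ 0# → t ⁻¹ ≢ 0#
  ⁻¹-nonZero t t≢0 t⁻¹≡0 = 0≢1 (trans (sym (zeroʳ t)) (trans (cong (t ⊗_) (sym t⁻¹≡0)) (⁻¹-inverse t t≢0)))

  root-unique : ∀ t a d → t ≢ 0# → a ⊗ t ⊕ d ≡ 0# → a ≡ ⊝ d ⊗ t ⁻¹
  root-unique t a d t≢0 e = begin
    a                ≡⟨ *-identityʳ a ⟨
    a ⊗ 1#           ≡⟨ cong (a ⊗_) (⁻¹-inverse t t≢0) ⟨
    a ⊗ (t ⊗ t ⁻¹)   ≡⟨ *-assoc a t (t ⁻¹) ⟨
    a ⊗ t ⊗ t ⁻¹     ≡⟨ cong (_⊗ t ⁻¹) (inverseˡ-unique _ d e) ⟩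
    ⊝ d ⊗ t ⁻¹       ∎
    where open ≡-Reasoning

  root-is-root : ∀ t d → t ≢ 0# → ⊝ d ⊗ t ⁻¹ ⊗ t ⊕ d ≡ 0#
  root-is-root t d t≢0 = begin
    ⊝ d ⊗ t ⁻¹ ⊗ t ⊕ d     ≡⟨ cong (_⊕ d) (*-assoc (⊝ d) (t ⁻¹) t) ⟩
    ⊝ d ⊗ (t ⁻¹ ⊗ t) ⊕ d   ≡⟨ cong (λ z → ⊝ d ⊗ z ⊕ d) (⁻¹-inverseˡ t t≢0) ⟩
    ⊝ d ⊗ 1# ⊕ d           ≡⟨ cong (_⊕ d) (*-identityʳ (⊝ d)) ⟩
    ⊝ d ⊕ d                ≡⟨ -‿inverseˡ d ⟩
    0#                     ∎
    where open ≡-Reasoning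

  monic-root-unique : ∀ a d → a ⊗ 1# ⊕ d ≡ 0# → a ≡ ⊝ d
  monic-root-unique a d e = trans (sym (*-identityʳ a)) (inverseˡ-unique _ d e)

  monic-root-is-root : ∀ d → ⊝ d ⊗ 1# ⊕ d ≡ 0#
  monic-root-is-root d = trans (cong (_⊕ d) (*-identityʳ (⊝ d))) (-‿inverseˡ d)

  ⊗0⊕ : ∀ a d → a ⊗ 0# ⊕ d ≡ d
  ⊗0⊕ a d = trans (cong (_⊕ d) (zeroʳ a)) (+-identityˡ d)

  scale : ∀ {m} → Carrier → Vec Carrier m → Vec Carrier m
  scale c = map (c ⊗_)

  zeros : ∀ {m} → Vec Carrier m
  zeros = replicate _ 0#

  infixl 6 _⊕ᵛ_
  _⊕ᵛ_ : ∀ {m} → Vec Carrier m → Vec Carrier m → Vec Carrier m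
  _⊕ᵛ_ = zipWith _⊕_

  dot-comm : ∀ {m} (a b : Vec Carrier m) → dot a b ≡ dot b a
  dot-comm []      []      = refl
  dot-comm (x ∷ a) (y ∷ b) = cong₂ _⊕_ (*-comm x y) (dot-comm a b)

  dot-scaleˡ : ∀ {m} c (a b : Vec Carrier m) → dot (scale c a) b ≡ c ⊗ dot a b
  dot-scaleˡ c []      []      = sym (zeroʳ c)
  dot-scaleˡ c (x ∷ a) (y ∷ b) = begin
    c ⊗ x ⊗ y ⊕ dot (scale c a) b  ≡⟨ cong₂ _⊕_ (*-assoc c x y) (dot-scaleˡ c a b) ⟩
    c ⊗ (x ⊗ y) ⊕ c ⊗ dot a b      ≡⟨ distribˡ c _ _ ⟨
    c ⊗ (x ⊗ y ⊕ dot a b)          ∎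
    where open ≡-Reasoning

  dot-scaleʳ : ∀ {m} c (a b : Vec Carrier m) → dot a (scale c b) ≡ c ⊗ dot a b
  dot-scaleʳ c a b = trans (dot-comm a (scale c b)) (trans (dot-scaleˡ c b a) (cong (c ⊗_) (dot-comm b a)))

  dot-⊕ᵛ : ∀ {m} (a u v : Vec Carrier m) → dot a (u ⊕ᵛ v) ≡ dot a u ⊕ dot a v
  dot-⊕ᵛ []      []      []      = sym (+-identityˡ 0#)
  dot-⊕ᵛ (x ∷ a) (y ∷ u) (z ∷ v) = begin
    x ⊗ (y ⊕ z) ⊕ dot a (u ⊕ᵛ v)            ≡⟨ cong₂ _⊕_ (distribˡ x y z) (dot-⊕ᵛ a u v) ⟩
    (x ⊗ y ⊕ x ⊗ z) ⊕ (dot a u ⊕ dot a v)   ≡⟨ interchange _ _ _ _ ⟩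
    (x ⊗ y ⊕ dot a u) ⊕ (x ⊗ z ⊕ dot a v)   ∎
    where open ≡-Reasoning

  dot-⊕ᵛ-scale-⊝ : ∀ {m} (a x p : Vec Carrier m) c → dot a (x ⊕ᵛ scale (⊝ c) p) ≡ ⊝ dot a p ⊗ c ⊕ dot a x
  dot-⊕ᵛ-scale-⊝ a x p c = begin
    dot a (x ⊕ᵛ scale (⊝ c) p)       ≡⟨ dot-⊕ᵛ a x _ ⟩
    dot a x ⊕ dot a (scale (⊝ c) p)  ≡⟨ cong (dot a x ⊕_) (dot-scaleʳ (⊝ c) a p) ⟩
    dot a x ⊕ ⊝ c ⊗ dot a p          ≡⟨ cong (dot a x ⊕_) (-‿distribˡ-* c (dot a p)) ⟨
    dot a x ⊕ ⊝ (c ⊗ dot a p)        ≡⟨ cong (dot a x ⊕_) (-‿distribʳ-* c (dot a p)) ⟩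
    dot a x ⊕ c ⊗ ⊝ dot a p          ≡⟨ cong (dot a x ⊕_) (*-comm c _) ⟩
    dot a x ⊕ ⊝ dot a p ⊗ c          ≡⟨ +-comm _ _ ⟩
    ⊝ dot a p ⊗ c ⊕ dot a x          ∎
    where open ≡-Reasoning

  dot-zerosˡ : ∀ {m} (v : Vec Carrier m) → dot zeros v ≡ 0#
  dot-zerosˡ []      = refl
  dot-zerosˡ (x ∷ v) = trans (cong₂ _⊕_ (zeroˡ x) (dot-zerosˡ v)) (+-identityˡ 0#)

  scale-scale : ∀ {m} c d (v : Vec Carrier m) → scale c (scale d v) ≡ scale (c ⊗ d) v
  scale-scale c d v = trans (sym (Vec.map-∘ (c ⊗_) (d ⊗_) v)) (Vec.map-cong (λ x → sym (*-assoc c d x)) v)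

  scale-1 : ∀ {m} (v : Vec Carrier m) → scale 1# v ≡ v
  scale-1 v = trans (Vec.map-cong *-identityˡ v) (Vec.map-id v)

  scale-0 : ∀ {m} (v : Vec Carrier m) → scale 0# v ≡ zeros
  scale-0 []      = refl
  scale-0 (x ∷ v) = cong₂ _∷_ (zeroˡ x) (scale-0 v)

  scale-⁻¹-scale : ∀ {m} c (v : Vec Carrier m) → c ≢ 0# → scale (c ⁻¹) (scale c v) ≡ v
  scale-⁻¹-scale c v c≢0 = trans (scale-scale (c ⁻¹) c v) (trans (cong (λ z → scale z v) (⁻¹-inverseˡ c c≢0)) (scale-1 v))

  scale-scale-⁻¹ : ∀ {m} c (v : Vec Carrier m) → c ≢ 0# → scale c (scale (c ⁻¹) v) ≡ v
  scale-scale-⁻¹ c v c≢0 = trans (scale-scale c (c ⁻¹) v) (trans (cong (λ z → scale z v) (⁻¹-inverse c c≢0)) (scale-1 v))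

  ⊕ᵛ-scale-⊝≡zeros : ∀ {m} (x p : Vec Carrier m) c → x ⊕ᵛ scale (⊝ c) p ≡ zeros → x ≡ scale c p
  ⊕ᵛ-scale-⊝≡zeros []      []      c e = refl
  ⊕ᵛ-scale-⊝≡zeros (a ∷ x) (b ∷ p) c e =
    cong₂ _∷_ a≡cb (⊕ᵛ-scale-⊝≡zeros x p c (cong tail e))
    where
    a≡cb : a ≡ c ⊗ b
    a≡cb = begin
      a                ≡⟨ inverseˡ-unique a _ (cong head e) ⟩
      ⊝ (⊝ c ⊗ b)      ≡⟨ cong ⊝_ (-‿distribˡ-* c b) ⟨
      ⊝ (⊝ (c ⊗ b))    ≡⟨ ⁻¹-involutive (c ⊗ b) ⟩
      c ⊗ b            ∎
      where open ≡-Reasoning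

  ¬normalized-zeros : ∀ {m} → ¬ Normalized (zeros {m})
  ¬normalized-zeros {suc m} (inj₁ 0≡1)     = 0≢1 0≡1
  ¬normalized-zeros {suc m} (inj₂ (_ , n)) = ¬normalized-zeros {m} n

  normalized⇒≢zeros : ∀ {m} {v : Vec Carrier m} → Normalized v → v ≢ zeros
  normalized⇒≢zeros n refl = ¬normalized-zeros n

  normalized-irrelevant : ∀ {m} (v : Vec Carrier m) (a b : Normalized v) → a ≡ b
  normalized-irrelevant (x ∷ v) (inj₁ e)       (inj₁ e')       = cong inj₁ (Decidable⇒UIP.≡-irrelevant _≟_ e e')
  normalized-irrelevant (x ∷ v) (inj₁ e)       (inj₂ (e' , _)) = ⊥-elim (0≢1 (trans (sym e') e))
  normalized-irrelevant (x ∷ v) (inj₂ (e , _)) (inj₁ e')       = ⊥-elim (0≢1 (trans (sym e) e'))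
  normalized-irrelevant (x ∷ v) (inj₂ (e , a)) (inj₂ (e' , b)) =
    cong₂ (λ e n → inj₂ (e , n)) (Decidable⇒UIP.≡-irrelevant _≟_ e e') (normalized-irrelevant v a b)

  _≟ᵛ_ : ∀ {m} → DecidableEquality (Vec Carrier m)
  _≟ᵛ_ = Vec.≡-dec _≟_

  _≟ᴺ_ : ∀ {m} → DecidableEquality (NVec m)
  (v , a) ≟ᴺ (w , b) with v ≟ᵛ w
  ... | yes refl = yes (cong (v ,_) (normalized-irrelevant v a b))
  ... | no v≢w   = no (λ e → v≢w (cong proj₁ e))

  NotMultipleOf : ∀ {m} → Vec Carrier m → Vec Carrier m → Set
  NotMultipleOf p x = ∀ c → x ≢ scale c p

  distinct⇒notMultipleOf : ∀ {m} (p x : Vec Carrier m) → Normalized p → Normalized x → p ≢ x → NotMultipleOf p x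
  distinct⇒notMultipleOf (_ ∷ p) (_ ∷ x) (inj₁ refl) (inj₁ refl) p≢x c e =
    p≢x (cong (1# ∷_) (sym (trans (cong tail e) (trans (cong (λ z → scale z p) c≡1) (scale-1 p)))))
    where
    c≡1 : c ≡ 1#
    c≡1 = trans (sym (*-identityʳ c)) (sym (cong head e))
  distinct⇒notMultipleOf (_ ∷ p) (_ ∷ x) (inj₁ refl) (inj₂ (refl , nx)) p≢x c e =
    ¬normalized-zeros (subst Normalized (trans (cong tail e) (trans (cong (λ z → scale z p) c≡0) (scale-0 p))) nx)
    where
    c≡0 : c ≡ 0#
    c≡0 = trans (sym (*-identityʳ c)) (sym (cong head e))
  distinct⇒notMultipleOf (_ ∷ p) (_ ∷ x) (inj₂ (refl , np)) (inj₁ refl) p≢x c e =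
    0≢1 (sym (trans (cong head e) (zeroʳ c)))
  distinct⇒notMultipleOf (_ ∷ p) (_ ∷ x) (inj₂ (refl , np)) (inj₂ (refl , nx)) p≢x c e =
    distinct⇒notMultipleOf p x np nx (λ p≡x → p≢x (cong (0# ∷_) p≡x)) c (cong tail e)

module ProjectiveCounting (F : Field) (r : ℕ) (#F : HasCount (λ (_ : Field.Carrier F) → ⊤) (2 + r)) where
  open import Data.Nat using (zero; suc; _*_; _^_)
  open import Data.Nat.Properties using (*-identityˡ; *-identityʳ; *-zeroʳ; *-distribˡ-+; +-assoc; +-comm; +-cancelˡ-≡)
  open import Data.List using (List; []; _∷_; _++_; map; cartesianProductWith)
  open import Data.List.Membership.Propositional using (_∈_)
  open import Data.List.Membership.Propositional.Properties
    using (∈-cartesianProductWith⁺; ∈-map⁺; ∈-map⁻; ∈-++⁺ˡ; ∈-++⁺ʳ)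
  open import Data.List.Relation.Unary.Any using (here)
  open import Data.List.Relation.Unary.All using ([])
  open import Data.List.Relation.Unary.AllPairs using ([]; _∷_)
  open import Data.List.Relation.Unary.Unique.Propositional using (Unique)
  import Data.List.Relation.Unary.Unique.Propositional.Properties as Unique
  open import Data.Vec using (Vec; []; _∷_; head)
  open import Data.Product using (Σ; _×_; _,_; proj₁; proj₂)
  open import Data.Sum using (inj₁; inj₂)
  open import Data.Unit using (tt)
  open import Data.Empty using (⊥; ⊥-elim)
  open import Relation.Nullary using (Dec; yes; no; ¬_)
  open import Relation.Nullary.Decidable using (¬?; _×-dec_)
  open import Relation.Binary.PropositionalEquality
    using (_≡_; _≢_; refl; sym; trans; cong; cong₂; subst; module ≡-Reasoning)
  open FiniteSum
  open QNumber r public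

  open Field F
    renaming (_+_ to infixl 6 _⊕_; _*_ to infixl 7 _⊗_; -_ to infix 8 ⊝_; _⁻¹ to infix 9 _⁻¹; _≟_ to infix 4 _≟_)
  open PG F using (dot; Normalized)
  open FieldVectors F
  open import Algebra.Bundles using (CommutativeRing)
  module R = CommutativeRing ring

  elements : List Carrier
  elements = proj₁ #F

  elements-unique : Unique elements
  elements-unique = proj₁ (proj₂ #F)

  ∈-elements : ∀ c → c ∈ elements
  ∈-elements c = proj₁ (proj₂ (proj₂ (proj₂ #F))) c tt

  ∑-elements-const : ∀ k → ∑[ _ ∈ elements ] k ≡ q * k
  ∑-elements-const k = trans (∑-const elements k) (cong (_* k) (proj₂ (proj₂ (proj₂ (proj₂ #F)))))

  ∑-elements-split : ∀ (f : Carrier → ℕ) → ∑ elements f ≡ f 0# + ∑[ c ∈ elements ] (χ (¬? (c ≟ 0#)) * f c)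
  ∑-elements-split f = ∑-split _≟_ f elements-unique (∈-elements 0#)

  ∑-nonZero-const : ∀ k → ∑[ c ∈ elements ] (χ (¬? (c ≟ 0#)) * k) ≡ q-1 * k
  ∑-nonZero-const k = +-cancelˡ-≡ k _ _ (trans (sym (∑-elements-split (λ _ → k))) (∑-elements-const k))

  ∑-elements-single : ∀ (f : Carrier → ℕ) s → (∀ c → c ≢ s → f c ≡ 0) → ∑ elements f ≡ f s
  ∑-elements-single f s = ∑-single f elements-unique (∈-elements s)

  vecs : (m : ℕ) → List (Vec Carrier m)
  vecs zero    = [] ∷ []
  vecs (suc m) = cartesianProductWith _∷_ elements (vecs m)

  vecs-unique : ∀ m → Unique (vecs m)
  vecs-unique zero    = [] ∷ []
  vecs-unique (suc m) = Unique.cartesianProductWith⁺ _∷_ (λ { refl → refl , refl }) elements-unique (vecs-unique m)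

  ∈-vecs : ∀ {m} (v : Vec Carrier m) → v ∈ vecs m
  ∈-vecs []      = here refl
  ∈-vecs (c ∷ v) = ∈-cartesianProductWith⁺ _∷_ (∈-elements c) (∈-vecs v)

  ∑-vecs-suc : ∀ m (f : Vec Carrier (suc m) → ℕ) → ∑ (vecs (suc m)) f ≡ ∑[ c ∈ elements ] ∑[ v ∈ vecs m ] f (c ∷ v)
  ∑-vecs-suc m f = ∑-cartesianProductWith _∷_ elements (vecs m) f

  #vecs : ∀ m → ∑[ _ ∈ vecs m ] 1 ≡ q ^ m
  #vecs zero    = refl
  #vecs (suc m) = trans (∑-vecs-suc m _) (trans (∑-cong elements (λ _ → #vecs m)) (∑-elements-const (q ^ m)))

  ∑-vecs-bijection : ∀ m (h h⁻¹ : Vec Carrier m → Vec Carrier m) →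
                     (∀ v → h (h⁻¹ v) ≡ v) → (∀ v → h⁻¹ (h v) ≡ v) →
                     (f : Vec Carrier m → ℕ) → ∑[ v ∈ vecs m ] f (h v) ≡ ∑ (vecs m) f
  ∑-vecs-bijection m h h⁻¹ h∘h⁻¹ h⁻¹∘h f =
    trans (sym (∑-map h (vecs m) f))
          (∑-enumeration f (Unique.map⁺ h-injective (vecs-unique m)) (vecs-unique m)
                         (λ v _ → ∈-vecs v) (λ v _ → subst (_∈ map h (vecs m)) (h∘h⁻¹ v) (∈-map⁺ h (∈-vecs (h⁻¹ v)))))
    where
    h-injective : ∀ {v w} → h v ≡ h w → v ≡ w
    h-injective {v} {w} e = trans (sym (h⁻¹∘h v)) (trans (cong h⁻¹ e) (h⁻¹∘h w))

  NV : ℕ → Set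
  NV m = Σ (Vec Carrier m) Normalized

  leading1 : ∀ {m} → Vec Carrier m → NV (suc m)
  leading1 v = 1# ∷ v , inj₁ refl

  leading0 : ∀ {m} → NV m → NV (suc m)
  leading0 (w , n) = 0# ∷ w , inj₂ (refl , n)

  normalizedVecs : (m : ℕ) → List (NV m)
  normalizedVecs zero    = []
  normalizedVecs (suc m) = map leading1 (vecs m) ++ map leading0 (normalizedVecs m)

  normalizedVecs-unique : ∀ m → Unique (normalizedVecs m)
  normalizedVecs-unique zero    = []
  normalizedVecs-unique (suc m) =
    Unique.++⁺ (Unique.map⁺ (λ { refl → refl }) (vecs-unique m)) (Unique.map⁺ (λ { refl → refl }) (normalizedVecs-unique m))
               disjoint
    where
    disjoint : ∀ {b} → b ∈ map leading1 (vecs m) × b ∈ map leading0 (normalizedVecs m) → ⊥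
    disjoint (i , j) with ∈-map⁻ leading1 i | ∈-map⁻ leading0 j
    ... | _ , _ , refl | _ , _ , e = 0≢1 (sym (cong (λ b → head (proj₁ b)) e))

  ∈-normalizedVecs : ∀ {m} (b : NV m) → b ∈ normalizedVecs m
  ∈-normalizedVecs {suc m} (_ ∷ v , inj₁ refl)       = ∈-++⁺ˡ (∈-map⁺ leading1 (∈-vecs v))
  ∈-normalizedVecs {suc m} (_ ∷ v , inj₂ (refl , n)) =
    ∈-++⁺ʳ (map leading1 (vecs m)) (∈-map⁺ leading0 (∈-normalizedVecs (v , n)))

  ∑-normalizedVecs-suc : ∀ m (f : NV (suc m) → ℕ) →
    ∑ (normalizedVecs (suc m)) f ≡ ∑[ v ∈ vecs m ] f (leading1 v) + ∑[ w ∈ normalizedVecs m ] f (leading0 w)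
  ∑-normalizedVecs-suc m f =
    trans (∑-++ (map leading1 (vecs m)) _ f) (cong₂ _+_ (∑-map leading1 (vecs m) f) (∑-map leading0 (normalizedVecs m) f))

  #normalizedVecs : ∀ m → ∑[ _ ∈ normalizedVecs m ] 1 ≡ θ m
  #normalizedVecs zero    = refl
  #normalizedVecs (suc m) = trans (∑-normalizedVecs-suc m (λ _ → 1)) (cong₂ _+_ (#vecs m) (#normalizedVecs m))

  #scaleInvariant :
    ∀ m {P : Vec Carrier m → Set} (P? : ∀ v → Dec (P v)) → (∀ c v → c ≢ 0# → P v → P (scale c v)) →
    ∑[ v ∈ vecs m ] χ (P? v) ≡ χ (P? zeros) + q-1 * ∑[ b ∈ normalizedVecs m ] χ (P? (proj₁ b))
  #scaleInvariant zero    P? invariant = cong (χ (P? []) +_) (sym (*-zeroʳ q-1))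
  #scaleInvariant (suc m) {P} P? invariant = begin
      ∑[ v ∈ vecs (suc m) ] χ (P? v)
    ≡⟨ ∑-vecs-suc m _ ⟩
      ∑[ c ∈ elements ] ∑[ v ∈ vecs m ] χ (P? (c ∷ v))
    ≡⟨ ∑-elements-split _ ⟩
      #leading0 + ∑[ c ∈ elements ] (χ (¬? (c ≟ 0#)) * ∑[ v ∈ vecs m ] χ (P? (c ∷ v)))
    ≡⟨ cong (#leading0 +_) (∑-cong elements nonZeroLeading) ⟩
      #leading0 + ∑[ c ∈ elements ] (χ (¬? (c ≟ 0#)) * #leading1)
    ≡⟨ cong (#leading0 +_) (∑-nonZero-const #leading1) ⟩
      #leading0 + q-1 * #leading1
    ≡⟨ cong (_+ q-1 * #leading1) (#scaleInvariant m (λ v → P? (0# ∷ v)) invariant0) ⟩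
      χ (P? zeros) + q-1 * #normalizedLeading0 + q-1 * #leading1
    ≡⟨ +-assoc (χ (P? zeros)) _ _ ⟩
      χ (P? zeros) + (q-1 * #normalizedLeading0 + q-1 * #leading1)
    ≡⟨ cong (χ (P? zeros) +_) (trans (sym (*-distribˡ-+ q-1 #normalizedLeading0 #leading1))
                                     (cong (q-1 *_) (+-comm #normalizedLeading0 #leading1))) ⟩
      χ (P? zeros) + q-1 * (#leading1 + #normalizedLeading0)
    ≡⟨ cong (λ z → χ (P? zeros) + q-1 * z) (∑-normalizedVecs-suc m (λ b → χ (P? (proj₁ b)))) ⟨
      χ (P? zeros) + q-1 * ∑[ b ∈ normalizedVecs (suc m) ] χ (P? (proj₁ b))
    ∎
    where
    open ≡-Reasoning
    #leading0 #leading1 #normalizedLeading0 : ℕ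
    #leading0 = ∑[ v ∈ vecs m ] χ (P? (0# ∷ v))
    #leading1 = ∑[ v ∈ vecs m ] χ (P? (1# ∷ v))
    #normalizedLeading0 = ∑[ b ∈ normalizedVecs m ] χ (P? (0# ∷ proj₁ b))

    invariant0 : ∀ c v → c ≢ 0# → P (0# ∷ v) → P (0# ∷ scale c v)
    invariant0 c v c≢0 p = subst P (cong (_∷ scale c v) (R.zeroʳ c)) (invariant c (0# ∷ v) c≢0 p)

    -- v ↦ c⁻¹ v matches the vectors c ∷ v satisfying P with those 1 ∷ v satisfying P
    leading : ∀ c → c ≢ 0# → ∑[ v ∈ vecs m ] χ (P? (c ∷ v)) ≡ #leading1
    leading c c≢0 =
      trans (∑-cong (vecs m) rescale)
            (∑-vecs-bijection m (scale (c ⁻¹)) (scale c) (λ v → scale-⁻¹-scale c v c≢0) (λ v → scale-scale-⁻¹ c v c≢0)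
                              (λ v → χ (P? (1# ∷ v))))
      where
      rescale : ∀ v → χ (P? (c ∷ v)) ≡ χ (P? (1# ∷ scale (c ⁻¹) v))
      rescale v = χ-cong
        (λ p → subst P (cong (_∷ scale (c ⁻¹) v) (⁻¹-inverseˡ c c≢0)) (invariant (c ⁻¹) (c ∷ v) (⁻¹-nonZero c c≢0) p))
        (λ p → subst P (cong₂ _∷_ (R.*-identityʳ c) (scale-scale-⁻¹ c v c≢0)) (invariant c _ c≢0 p))
        (P? (c ∷ v)) (P? (1# ∷ scale (c ⁻¹) v))

    nonZeroLeading : ∀ c → χ (¬? (c ≟ 0#)) * ∑[ v ∈ vecs m ] χ (P? (c ∷ v)) ≡ χ (¬? (c ≟ 0#)) * #leading1
    nonZeroLeading c with c ≟ 0#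
    ... | yes _   = refl
    ... | no c≢0 = cong (1 *_) (leading c c≢0)

  #roots-linear : ∀ t d → t ≢ 0# → ∑[ a ∈ elements ] χ (a ⊗ t ⊕ d ≟ 0#) ≡ 1
  #roots-linear t d t≢0 =
    trans (∑-elements-single _ (⊝ d ⊗ t ⁻¹)
             (λ a a≢root → χ-no (a ⊗ t ⊕ d ≟ 0#) (λ e → a≢root (root-unique t a d t≢0 e))))
          (χ-yes (⊝ d ⊗ t ⁻¹ ⊗ t ⊕ d ≟ 0#) (root-is-root t d t≢0))

  χ-⊗0⊕ : ∀ a d → χ (a ⊗ 0# ⊕ d ≟ 0#) ≡ χ (d ≟ 0#)
  χ-⊗0⊕ a d = χ-cong (trans (sym (⊗0⊕ a d))) (trans (⊗0⊕ a d)) (a ⊗ 0# ⊕ d ≟ 0#) (d ≟ 0#)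

  #orthogonal : ∀ m (w : Vec Carrier (suc m)) → w ≢ zeros → ∑[ a ∈ vecs (suc m) ] χ (dot a w ≟ 0#) ≡ q ^ m
  #orthogonal m (w₀ ∷ w) w≢0 with w₀ ≟ 0#
  ... | no w₀≢0 = begin
      ∑[ a ∈ vecs (suc m) ] χ (dot a (w₀ ∷ w) ≟ 0#)
    ≡⟨ ∑-vecs-suc m _ ⟩
      ∑[ a₀ ∈ elements ] ∑[ a ∈ vecs m ] χ (a₀ ⊗ w₀ ⊕ dot a w ≟ 0#)
    ≡⟨ ∑-comm elements (vecs m) _ ⟩
      ∑[ a ∈ vecs m ] ∑[ a₀ ∈ elements ] χ (a₀ ⊗ w₀ ⊕ dot a w ≟ 0#)
    ≡⟨ ∑-cong (vecs m) (λ a → #roots-linear w₀ (dot a w) w₀≢0) ⟩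
      ∑[ _ ∈ vecs m ] 1
    ≡⟨ #vecs m ⟩
      q ^ m
    ∎
    where open ≡-Reasoning
  #orthogonal zero    (w₀ ∷ []) w≢0 | yes refl = ⊥-elim (w≢0 refl)
  #orthogonal (suc m) (w₀ ∷ w)  w≢0 | yes refl = begin
      ∑[ a ∈ vecs (suc (suc m)) ] χ (dot a (0# ∷ w) ≟ 0#)
    ≡⟨ ∑-vecs-suc (suc m) _ ⟩
      ∑[ a₀ ∈ elements ] ∑[ a ∈ vecs (suc m) ] χ (a₀ ⊗ 0# ⊕ dot a w ≟ 0#)
    ≡⟨ ∑-cong elements (λ a₀ → ∑-cong (vecs (suc m)) (λ a → χ-⊗0⊕ a₀ (dot a w))) ⟩
      ∑[ _ ∈ elements ] ∑[ a ∈ vecs (suc m) ] χ (dot a w ≟ 0#)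
    ≡⟨ ∑-elements-const _ ⟩
      q * ∑[ a ∈ vecs (suc m) ] χ (dot a w ≟ 0#)
    ≡⟨ cong (q *_) (#orthogonal m w (λ w≡0 → w≢0 (cong (0# ∷_) w≡0))) ⟩
      q ^ suc m
    ∎
    where open ≡-Reasoning

  ∑-monic-root : ∀ d (g : Carrier → ℕ) → ∑[ a ∈ elements ] (χ (a ⊗ 1# ⊕ d ≟ 0#) * g a) ≡ g (⊝ d)
  ∑-monic-root d g =
    trans (∑-elements-single _ (⊝ d)
             (λ a a≢root → cong (_* g a) (χ-no (a ⊗ 1# ⊕ d ≟ 0#) (λ e → a≢root (monic-root-unique a d e)))))
          (trans (cong (_* g (⊝ d)) (χ-yes (⊝ d ⊗ 1# ⊕ d ≟ 0#) (monic-root-is-root d))) (*-identityˡ (g (⊝ d))))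

  normalized¹-multiple : ∀ (p x : Vec Carrier 1) → Normalized p → ¬ NotMultipleOf p x
  normalized¹-multiple (_ ∷ []) (y ∷ []) (inj₁ refl) notMultiple = notMultiple y (cong (_∷ []) (sym (R.*-identityʳ y)))

  -- Eliminating a₀ with the first equation leaves the single equation a · (x - x₀ p) = 0.
  #orthogonal₂-monic : ∀ m (p x : Vec Carrier (suc m)) x₀ → NotMultipleOf (1# ∷ p) (x₀ ∷ x) →
    ∑[ a ∈ vecs (suc (suc m)) ] (χ (dot a (1# ∷ p) ≟ 0#) * χ (dot a (x₀ ∷ x) ≟ 0#)) ≡ q ^ m
  #orthogonal₂-monic m p x x₀ notMultiple = begin
      ∑[ a ∈ vecs (suc (suc m)) ] (χ (dot a (1# ∷ p) ≟ 0#) * χ (dot a (x₀ ∷ x) ≟ 0#))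
    ≡⟨ ∑-vecs-suc (suc m) _ ⟩
      ∑[ a₀ ∈ elements ] ∑[ a ∈ vecs (suc m) ] (χ (a₀ ⊗ 1# ⊕ dot a p ≟ 0#) * χ (a₀ ⊗ x₀ ⊕ dot a x ≟ 0#))
    ≡⟨ ∑-comm elements (vecs (suc m)) _ ⟩
      ∑[ a ∈ vecs (suc m) ] ∑[ a₀ ∈ elements ] (χ (a₀ ⊗ 1# ⊕ dot a p ≟ 0#) * χ (a₀ ⊗ x₀ ⊕ dot a x ≟ 0#))
    ≡⟨ ∑-cong (vecs (suc m)) (λ a → ∑-monic-root (dot a p) (λ a₀ → χ (a₀ ⊗ x₀ ⊕ dot a x ≟ 0#))) ⟩
      ∑[ a ∈ vecs (suc m) ] χ (⊝ dot a p ⊗ x₀ ⊕ dot a x ≟ 0#)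
    ≡⟨ ∑-cong (vecs (suc m)) (λ a → χ-cong (trans (dot-⊕ᵛ-scale-⊝ a x p x₀)) (trans (sym (dot-⊕ᵛ-scale-⊝ a x p x₀)))
                                           (_ ≟ 0#) (dot a w ≟ 0#)) ⟩
      ∑[ a ∈ vecs (suc m) ] χ (dot a w ≟ 0#)
    ≡⟨ #orthogonal m w w≢0 ⟩
      q ^ m
    ∎
    where
    open ≡-Reasoning
    w : Vec Carrier (suc m)
    w = x ⊕ᵛ scale (⊝ x₀) p

    w≢0 : w ≢ zeros
    w≢0 w≡0 = notMultiple x₀ (cong₂ _∷_ (sym (R.*-identityʳ x₀)) (⊕ᵛ-scale-⊝≡zeros x p x₀ w≡0))

  #orthogonal₂-leading0 : ∀ m (p x : Vec Carrier (suc m)) x₀ → Normalized p → x₀ ≢ 0# →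
    ∑[ a ∈ vecs (suc (suc m)) ] (χ (dot a (0# ∷ p) ≟ 0#) * χ (dot a (x₀ ∷ x) ≟ 0#)) ≡ q ^ m
  #orthogonal₂-leading0 m p x x₀ np x₀≢0 = begin
      ∑[ a ∈ vecs (suc (suc m)) ] (χ (dot a (0# ∷ p) ≟ 0#) * χ (dot a (x₀ ∷ x) ≟ 0#))
    ≡⟨ ∑-vecs-suc (suc m) _ ⟩
      ∑[ a₀ ∈ elements ] ∑[ a ∈ vecs (suc m) ] (χ (a₀ ⊗ 0# ⊕ dot a p ≟ 0#) * χ (a₀ ⊗ x₀ ⊕ dot a x ≟ 0#))
    ≡⟨ ∑-comm elements (vecs (suc m)) _ ⟩
      ∑[ a ∈ vecs (suc m) ] ∑[ a₀ ∈ elements ] (χ (a₀ ⊗ 0# ⊕ dot a p ≟ 0#) * χ (a₀ ⊗ x₀ ⊕ dot a x ≟ 0#))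
    ≡⟨ ∑-cong (vecs (suc m)) (λ a → ∑-cong elements (λ a₀ →
         cong (_* χ (a₀ ⊗ x₀ ⊕ dot a x ≟ 0#)) (χ-⊗0⊕ a₀ (dot a p)))) ⟩
      ∑[ a ∈ vecs (suc m) ] ∑[ a₀ ∈ elements ] (χ (dot a p ≟ 0#) * χ (a₀ ⊗ x₀ ⊕ dot a x ≟ 0#))
    ≡⟨ ∑-cong (vecs (suc m)) (λ a → trans (∑-*ˡ elements (χ (dot a p ≟ 0#)) _)
                                          (cong (χ (dot a p ≟ 0#) *_) (#roots-linear x₀ (dot a x) x₀≢0))) ⟩
      ∑[ a ∈ vecs (suc m) ] (χ (dot a p ≟ 0#) * 1)
    ≡⟨ ∑-cong (vecs (suc m)) (λ a → *-identityʳ _) ⟩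
      ∑[ a ∈ vecs (suc m) ] χ (dot a p ≟ 0#)
    ≡⟨ #orthogonal m p (normalized⇒≢zeros np) ⟩
      q ^ m
    ∎
    where open ≡-Reasoning

  #orthogonal₂ : ∀ m (p x : Vec Carrier (suc (suc m))) → Normalized p → NotMultipleOf p x →
    ∑[ a ∈ vecs (suc (suc m)) ] (χ (dot a p ≟ 0#) * χ (dot a x ≟ 0#)) ≡ q ^ m
  #orthogonal₂ m (_ ∷ p) (x₀ ∷ x) (inj₁ refl)        notMultiple = #orthogonal₂-monic m p x x₀ notMultiple
  #orthogonal₂ m (_ ∷ p) (x₀ ∷ x) (inj₂ (refl , np)) notMultiple with x₀ ≟ 0#
  ... | no x₀≢0  = #orthogonal₂-leading0 m p x x₀ np x₀≢0
  ... | yes refl = begin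
      ∑[ a ∈ vecs (suc (suc m)) ] (χ (dot a (0# ∷ p) ≟ 0#) * χ (dot a (0# ∷ x) ≟ 0#))
    ≡⟨ ∑-vecs-suc (suc m) _ ⟩
      ∑[ a₀ ∈ elements ] ∑[ a ∈ vecs (suc m) ] (χ (a₀ ⊗ 0# ⊕ dot a p ≟ 0#) * χ (a₀ ⊗ 0# ⊕ dot a x ≟ 0#))
    ≡⟨ ∑-cong elements (λ a₀ → ∑-cong (vecs (suc m)) (λ a →
         cong₂ _*_ (χ-⊗0⊕ a₀ (dot a p)) (χ-⊗0⊕ a₀ (dot a x)))) ⟩
      ∑[ _ ∈ elements ] ∑[ a ∈ vecs (suc m) ] (χ (dot a p ≟ 0#) * χ (dot a x ≟ 0#))
    ≡⟨ ∑-elements-const _ ⟩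
      q * ∑[ a ∈ vecs (suc m) ] (χ (dot a p ≟ 0#) * χ (dot a x ≟ 0#))
    ≡⟨ afterLeadingZeros m p x np (λ c x≡cp → notMultiple c (cong₂ _∷_ (sym (R.zeroʳ c)) x≡cp)) ⟩
      q ^ m
    ∎
    where
    open ≡-Reasoning
    afterLeadingZeros : ∀ m (p x : Vec Carrier (suc m)) → Normalized p → NotMultipleOf p x →
                        q * ∑[ a ∈ vecs (suc m) ] (χ (dot a p ≟ 0#) * χ (dot a x ≟ 0#)) ≡ q ^ m
    afterLeadingZeros zero    p x np notMultiple = ⊥-elim (normalized¹-multiple p x np notMultiple)
    afterLeadingZeros (suc m) p x np notMultiple = cong (q *_) (#orthogonal₂ m p x np notMultiple)

  orthogonal-scale : ∀ {m} c (a w : Vec Carrier m) → dot a w ≡ 0# → dot (scale c a) w ≡ 0#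
  orthogonal-scale c a w e = trans (dot-scaleˡ c a w) (trans (cong (c ⊗_) e) (R.zeroʳ c))

  #normalized-orthogonal : ∀ m (p : NV (suc m)) →
    ∑[ b ∈ normalizedVecs (suc m) ] χ (dot (proj₁ b) (proj₁ p) ≟ 0#) ≡ θ m
  #normalized-orthogonal m (p , np) = θ-cancel m (begin
      suc (q-1 * ∑[ b ∈ normalizedVecs (suc m) ] χ (dot (proj₁ b) p ≟ 0#))
    ≡⟨ cong (_+ q-1 * ∑[ b ∈ normalizedVecs (suc m) ] χ (dot (proj₁ b) p ≟ 0#)) (χ-yes (dot zeros p ≟ 0#) (dot-zerosˡ p)) ⟨
      χ (dot zeros p ≟ 0#) + q-1 * ∑[ b ∈ normalizedVecs (suc m) ] χ (dot (proj₁ b) p ≟ 0#)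
    ≡⟨ #scaleInvariant (suc m) (λ a → dot a p ≟ 0#) (λ c a _ → orthogonal-scale c a p) ⟨
      ∑[ a ∈ vecs (suc m) ] χ (dot a p ≟ 0#)
    ≡⟨ #orthogonal m p (normalized⇒≢zeros np) ⟩
      q ^ m
    ∎)
    where open ≡-Reasoning

  #normalized-orthogonal₂ : ∀ m (p x : NV (suc (suc m))) → p ≢ x →
    ∑[ b ∈ normalizedVecs (suc (suc m)) ] (χ (dot (proj₁ b) (proj₁ p) ≟ 0#) * χ (dot (proj₁ b) (proj₁ x) ≟ 0#)) ≡ θ m
  #normalized-orthogonal₂ m (p , np) (x , nx) p≢x = θ-cancel m (begin
      suc (q-1 * ∑[ b ∈ normalizedVecs (suc (suc m)) ] (χ (dot (proj₁ b) p ≟ 0#) * χ (dot (proj₁ b) x ≟ 0#)))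
    ≡⟨ cong₂ _+_ (χ-yes (both? zeros) (dot-zerosˡ p , dot-zerosˡ x))
                 (cong (q-1 *_) (∑-cong (normalizedVecs (suc (suc m))) (λ b → χ-× (dot (proj₁ b) p ≟ 0#) _))) ⟨
      χ (both? zeros) + q-1 * ∑[ b ∈ normalizedVecs (suc (suc m)) ] χ (both? (proj₁ b))
    ≡⟨ #scaleInvariant (suc (suc m)) both?
         (λ c a _ (ap , ax) → orthogonal-scale c a p ap , orthogonal-scale c a x ax) ⟨
      ∑[ a ∈ vecs (suc (suc m)) ] χ (both? a)
    ≡⟨ ∑-cong (vecs (suc (suc m))) (λ a → χ-× (dot a p ≟ 0#) (dot a x ≟ 0#)) ⟩
      ∑[ a ∈ vecs (suc (suc m)) ] (χ (dot a p ≟ 0#) * χ (dot a x ≟ 0#))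
    ≡⟨ #orthogonal₂ m p x np (distinct⇒notMultipleOf p x np nx (λ { refl → p≢x (cong (p ,_) (normalized-irrelevant p np nx)) })) ⟩
      q ^ m
    ∎)
    where
    open ≡-Reasoning
    both? : ∀ a → Dec (dot a p ≡ 0# × dot a x ≡ 0#)
    both? a = (dot a p ≟ 0#) ×-dec (dot a x ≟ 0#)

module Incidence (F : Field) (r : ℕ) (#F : HasCount (λ (_ : Field.Carrier F) → ⊤) (2 + r)) (m : ℕ) where
  open import Data.Nat using (suc; _*_; _≤_; _<_; z≤n; s≤s)
  open import Data.Nat.Properties using (+-identityʳ)
  open import Data.Bool using (Bool; true; false)
  open import Data.Unit using (tt)
  open import Data.List using (List; []; _∷_; _++_; map; length)
  open import Data.List.Membership.Propositional using (_∈_)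
  open import Data.List.Membership.Propositional.Properties using (∈-map⁺; ∈-map⁻; ∈-++⁺ˡ; ∈-++⁺ʳ)
  open import Data.List.Relation.Unary.Linked using ([-]; _∷_)
  open import Data.List.Relation.Unary.Unique.Propositional using (Unique)
  import Data.List.Relation.Unary.Unique.Propositional.Properties as Unique
  open import Data.Product using (Σ; ∃; _×_; _,_; proj₁)
  open import Data.Sum using (inj₁; inj₂)
  import Data.Sum.Properties as Sum
  open import Data.Empty using (⊥; ⊥-elim)
  open import Relation.Nullary using (Dec; yes; no)
  open import Relation.Nullary.Decidable using (_×-dec_)
  open import Relation.Binary.Definitions using (DecidableEquality)
  open import Relation.Binary.PropositionalEquality using (_≡_; _≢_; refl; sym; trans; cong; cong₂; subst)
  open import Relation.Binary.Construct.Closure.ReflexiveTransitive using (Star; ε; _◅_; _◅◅_)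
  open FiniteSum
  open ProjectiveCounting F r #F

  open Field F using (0#) renaming (_≟_ to infix 4 _≟_)
  open PG F
  open FieldVectors F using (dot-comm; _≟ᴺ_; zeros)

  n : ℕ
  n = suc (suc m)

  *-positive : ∀ a b → 0 < a → 0 < b → 0 < a * b
  *-positive (suc a) (suc b) _ _ = s≤s z≤n

  G : Graph
  G = IncidenceGraph n

  nvecs : List (NVec n)
  nvecs = normalizedVecs (suc n)

  vertices : List (IVertex n)
  vertices = map inj₁ nvecs ++ map inj₂ nvecs

  vertices-unique : Unique vertices
  vertices-unique =
    Unique.++⁺ (Unique.map⁺ Sum.inj₁-injective (normalizedVecs-unique (suc n)))
               (Unique.map⁺ Sum.inj₂-injective (normalizedVecs-unique (suc n))) disjoint
    where
    disjoint : ∀ {v} → v ∈ map inj₁ nvecs × v ∈ map inj₂ nvecs → ⊥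
    disjoint (i , j) with ∈-map⁻ inj₁ i | ∈-map⁻ inj₂ j
    ... | _ , _ , refl | _ , _ , ()

  ∈-vertices : ∀ v → v ∈ vertices
  ∈-vertices (inj₁ p) = ∈-++⁺ˡ (∈-map⁺ inj₁ (∈-normalizedVecs p))
  ∈-vertices (inj₂ h) = ∈-++⁺ʳ (map inj₁ nvecs) (∈-map⁺ inj₂ (∈-normalizedVecs h))

  _≟ⱽ_ : DecidableEquality (IVertex n)
  _≟ⱽ_ = Sum.≡-dec _≟ᴺ_ _≟ᴺ_

  incident? : ∀ u v → Dec (IAdj {n} u v)
  incident? (inj₁ (p , _)) (inj₂ (h , _)) = dot h p ≟ 0#
  incident? (inj₂ (h , _)) (inj₁ (p , _)) = dot h p ≟ 0#
  incident? (inj₁ _)       (inj₁ _)       = no λ ()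
  incident? (inj₂ _)       (inj₂ _)       = no λ ()

  open FourCycles G _≟ⱽ_ incident? vertices vertices-unique ∈-vertices

  ∑-vertices : ∀ (f : IVertex n → ℕ) → ∑ vertices f ≡ ∑[ p ∈ nvecs ] f (inj₁ p) + ∑[ h ∈ nvecs ] f (inj₂ h)
  ∑-vertices f = trans (∑-++ (map inj₁ nvecs) _ f) (cong₂ _+_ (∑-map inj₁ nvecs f) (∑-map inj₂ nvecs f))

  ∑-hyperplanes : ∀ (f : IVertex n → ℕ) → (∀ p → f (inj₁ p) ≡ 0) → ∑ vertices f ≡ ∑[ h ∈ nvecs ] f (inj₂ h)
  ∑-hyperplanes f f≡0 = trans (∑-vertices f) (cong (_+ ∑[ h ∈ nvecs ] f (inj₂ h)) (∑-vanish nvecs (λ p _ → f≡0 p)))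

  ∑-nvecs : ∀ (f : IVertex n → ℕ) → (∀ h → f (inj₂ h) ≡ 0) → ∑ vertices f ≡ ∑[ p ∈ nvecs ] f (inj₁ p)
  ∑-nvecs f f≡0 =
    trans (∑-vertices f) (trans (cong (∑[ p ∈ nvecs ] f (inj₁ p) +_) (∑-vanish nvecs (λ h _ → f≡0 h))) (+-identityʳ _))

  χ-dot-comm : ∀ (a c : NVec n) → χ (dot (proj₁ a) (proj₁ c) ≟ 0#) ≡ χ (dot (proj₁ c) (proj₁ a) ≟ 0#)
  χ-dot-comm (a , _) (c , _) = χ-cong (trans (dot-comm c a)) (trans (dot-comm a c)) (dot a c ≟ 0#) (dot c a ≟ 0#)

  degree : ∀ v → ∑ vertices (A v) ≡ θ n
  degree (inj₁ p) = trans (∑-hyperplanes _ (λ _ → refl)) (#normalized-orthogonal n p)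
  degree (inj₂ h) = trans (∑-nvecs _ (λ _ → refl)) (trans (∑-cong nvecs (χ-dot-comm h)) (#normalized-orthogonal n h))

  commonNeighbours-nvecs : ∀ a b → a ≢ b → commonNeighbours (inj₁ a) (inj₁ b) ≡ θ (suc m)
  commonNeighbours-nvecs a b a≢b = trans (∑-hyperplanes _ (λ _ → refl)) (#normalized-orthogonal₂ (suc m) a b a≢b)

  commonNeighbours-hyperplanes : ∀ a b → a ≢ b → commonNeighbours (inj₂ a) (inj₂ b) ≡ θ (suc m)
  commonNeighbours-hyperplanes a b a≢b =
    trans (∑-nvecs _ (λ _ → refl))
    (trans (∑-cong nvecs (λ c → cong₂ _*_ (χ-dot-comm a c) (χ-dot-comm b c))) (#normalized-orthogonal₂ (suc m) a b a≢b))

  commonNeighbours-sameSide : ∀ u v x → IAdj u v → IAdj v x → x ≢ u → commonNeighbours x u ≡ θ (suc m)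
  commonNeighbours-sameSide (inj₁ b) (inj₂ _) (inj₁ a) _ _ x≢u = commonNeighbours-nvecs a b (λ { refl → x≢u refl })
  commonNeighbours-sameSide (inj₂ b) (inj₁ _) (inj₂ a) _ _ x≢u = commonNeighbours-hyperplanes a b (λ { refl → x≢u refl })

  fourCycles-incidence : ∀ u v → IAdj u v → fourCycles u v ≡ (q * θ m) * (q * θ (suc m))
  fourCycles-incidence u v uv =
    fourCycles-constant uv (q * θ m) (q * θ (suc m)) (trans (degree v) (θ-suc (suc m)))
      (λ x x≢u vx → trans (commonNeighbours-sameSide u v x uv vx x≢u) (θ-suc m))

  bipartite : Bipartite G
  bipartite = side , λ { {inj₁ _} {inj₂ _} _ () ; {inj₂ _} {inj₁ _} _ () }
    where
    side : IVertex n → Bool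
    side (inj₁ _) = true
    side (inj₂ _) = false

  neighbour : ∀ v → ∃ (IAdj v)
  neighbour v with ∑-pos⇒∃ vertices (A v) (subst (0 <_) (sym (degree v)) (θ-positive n (s≤s z≤n)))
  ... | w , _ , vw = w , χ-pos (incident? v w) vw

  commonNeighbour⇒path : ∀ x u → 0 < commonNeighbours x u → Star IAdj x u
  commonNeighbour⇒path x u pos with ∑-pos⇒∃ vertices _ pos
  ... | y , _ , xyu with χ-pos (incident? x y ×-dec incident? y u) (subst (0 <_) (sym (χ-× (incident? x y) _)) xyu)
  ... | xy , yu = xy ◅ yu ◅ ε

  nvecs-connected : ∀ a b → Star (IAdj {n}) (inj₁ a) (inj₁ b)
  nvecs-connected a b with a ≟ᴺ b
  ... | yes refl = ε
  ... | no a≢b   = commonNeighbour⇒path (inj₁ a) (inj₁ b)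
                     (subst (0 <_) (sym (commonNeighbours-nvecs a b a≢b)) (θ-positive (suc m) (s≤s z≤n)))

  hyperplanes-connected : ∀ a b → Star (IAdj {n}) (inj₂ a) (inj₂ b)
  hyperplanes-connected a b with a ≟ᴺ b
  ... | yes refl = ε
  ... | no a≢b   = commonNeighbour⇒path (inj₂ a) (inj₂ b)
                     (subst (0 <_) (sym (commonNeighbours-hyperplanes a b a≢b)) (θ-positive (suc m) (s≤s z≤n)))

  pointOn : ∀ h → Σ (NVec n) λ p → Incident p h
  pointOn h with neighbour (inj₂ h)
  ... | inj₁ p , hp = p , hp

  hyperplaneThrough : ∀ p → Σ (NVec n) λ h → Incident p h
  hyperplaneThrough p with neighbour (inj₁ p)
  ... | inj₂ h , ph = h , ph

  connected : Connected G
  connected (inj₁ a) (inj₁ b) = nvecs-connected a b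
  connected (inj₂ a) (inj₂ b) = hyperplanes-connected a b
  connected (inj₁ a) (inj₂ h) = let b , bh = pointOn h in nvecs-connected a b ◅◅ (bh ◅ ε)
  connected (inj₂ h) (inj₁ a) = let h' , ah' = hyperplaneThrough a in hyperplanes-connected h h' ◅◅ (ah' ◅ ε)

  #vertices : HasCount (λ (_ : IVertex n) → ⊤) (2 * θ (suc n))
  #vertices = subst (HasCount _) count (hasCount-∑χ vertices vertices-unique (λ v _ → ∈-vertices v) (λ _ → yes tt))
    where
    count : ∑[ _ ∈ vertices ] 1 ≡ 2 * θ (suc n)
    count = trans (∑-vertices _) (trans (cong₂ _+_ (#normalizedVecs (suc n)) (#normalizedVecs (suc n)))
                                        (cong (θ (suc n) +_) (sym (+-identityʳ _))))

  #neighbours : ∀ v → HasCount (IAdj v) (θ n)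
  #neighbours v = subst (HasCount (IAdj v)) (degree v) (hasCount-∑χ vertices vertices-unique (λ x _ → ∈-vertices x) (incident? v))

  #fourCycles : ∀ u v → IAdj u v → HasCount (CycleThrough G u v 4) ((q * θ m) * (q * θ (suc m)))
  #fourCycles u v uv = subst (HasCount (CycleThrough G u v 4)) (fourCycles-incidence u v uv) (hasCount-fourCycles uv)

  no-triangle : ∀ a b c → IAdj {n} a b → IAdj b c → IAdj c a → ⊥
  no-triangle (inj₁ _) (inj₁ _) _        () _  _
  no-triangle (inj₂ _) (inj₂ _) _        () _  _
  no-triangle (inj₁ _) (inj₂ _) (inj₁ _) _  _  ()
  no-triangle (inj₁ _) (inj₂ _) (inj₂ _) _  () _
  no-triangle (inj₂ _) (inj₁ _) (inj₂ _) _  _  ()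
  no-triangle (inj₂ _) (inj₁ _) (inj₁ _) _  () _

  hasGirth4 : 1 ≤ m → HasGirth G 4
  hasGirth4 1≤m = fourCycle , atLeast4
    where
    origin : IVertex n
    origin = inj₁ (leading1 zeros)

    fourCycle : ∃ λ c → IsCycle G c × length c ≡ 4
    fourCycle =
      let v , ov = neighbour origin
          c , cyc , len , _ = hasCount-pos⇒∃ (#fourCycles origin v ov)
            (*-positive (q * θ m) (q * θ (suc m)) (*-positive q (θ m) (s≤s z≤n) (θ-positive m 1≤m))
                        (*-positive q (θ (suc m)) (s≤s z≤n) (θ-positive (suc m) (s≤s z≤n))))
      in c , cyc , len

    atLeast4 : ∀ c → IsCycle G c → 4 ≤ length c
    atLeast4 (a ∷ b ∷ c ∷ [])      (_ , _ , ab ∷ bc ∷ ca ∷ [-]) = ⊥-elim (no-triangle a b c ab bc ca)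
    atLeast4 (_ ∷ _ ∷ _ ∷ _ ∷ _)   _                            = s≤s (s≤s (s≤s (s≤s z≤n)))
    atLeast4 (_ ∷ _ ∷ [])          (s≤s (s≤s ()) , _)
    atLeast4 (_ ∷ [])              (s≤s () , _)
    atLeast4 []                    (() , _)

  isEgr : 1 ≤ m → IsEgr G (2 * θ (suc n)) (θ n) 4 ((q * θ m) * (q * θ (suc m)))
  isEgr 1≤m = connected , #vertices , #neighbours , hasGirth4 1≤m , #fourCycles

open import Data.Nat using (z≤n; s≤s)
open import Data.Nat.Properties using (+-comm)
open import Data.Nat.Tactic.RingSolver using (solve-∀)
open import Data.Product using (_,_)
open import Relation.Binary.PropositionalEquality using (refl; sym; trans; cong; subst)
open ExtremalBound using (bipartiteEgr-order-bound)

isEgr-cong : ∀ (G : Graph) {N N' k k' λ₁ λ₂} → N ≡ N' → k ≡ k' → λ₁ ≡ λ₂ →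
             IsEgr G N k 4 λ₁ → IsEgr G N' k' 4 λ₂
isEgr-cong G refl refl refl egr = egr

module _ (F : Field) (r : ℕ) (#F : HasCount (λ (_ : Field.Carrier F) → ⊤) (2 + r)) where
  open QNumber r

  incidence-isEgr : ∀ m → 1 ≤ m → let n = suc (suc m) in
    IsEgr (PG.IncidenceGraph F n) (2 * ((q ^ (n + 1) ∸ 1) / (q ∸ 1))) ((q ^ n ∸ 1) / (q ∸ 1)) 4
          (((q ^ (2 * n ∸ 1) + q ^ 2) ∸ (q ^ (n + 1) + q ^ n)) / ((q ∸ 1) * (q ∸ 1)))
  incidence-isEgr m 1≤m =
    isEgr-cong _ (cong (2 *_) (sym (trans (θ-quotient (n + 1)) (cong θ (+-comm n 1)))))
                 (sym (θ-quotient n)) (sym (λ-quotient m)) (Incidence.isEgr F r #F m 1≤m)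
    where
    n : ℕ
    n = suc (suc m)

  incidence-extremal : IsExtremalBipartiteEgr (PG.IncidenceGraph F 3)
    (2 * ((q ^ (3 + 1) ∸ 1) / (q ∸ 1))) ((q ^ 3 ∸ 1) / (q ∸ 1)) 4
    (((q ^ (2 * 3 ∸ 1) + q ^ 2) ∸ (q ^ (3 + 1) + q ^ 3)) / ((q ∸ 1) * (q ∸ 1)))
  incidence-extremal =
    Incidence.bipartite F r #F 1 , incidence-isEgr 1 (s≤s z≤n) ,
    λ H M bipartite egr →
      subst (_≤ M) order≡ (bipartiteEgr-order-bound q H M bipartite (isEgr-cong H refl degree≡ λ≡ egr))
    where
    θ₃ : θ 3 ≡ suc (q * suc q)
    θ₃ = unfolded q
      where
      unfolded : ∀ x → x * (x * 1) + (x * 1 + (1 + 0)) ≡ suc (x * suc x)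
      unfolded = solve-∀
    θ₄ : θ 4 ≡ suc (suc (q * suc q) * q)
    θ₄ = unfolded q
      where
      unfolded : ∀ x → x * (x * (x * 1)) + (x * (x * 1) + (x * 1 + (1 + 0))) ≡ suc (suc (x * suc x) * x)
      unfolded = solve-∀
    qθ₁*qθ₂ : (q * θ 1) * (q * θ 2) ≡ q * q * suc q
    qθ₁*qθ₂ = unfolded q
      where
      unfolded : ∀ x → x * (1 + 0) * (x * (x * 1 + (1 + 0))) ≡ x * x * suc x
      unfolded = solve-∀
    degree≡ : (q ^ 3 ∸ 1) / (q ∸ 1) ≡ suc (q * suc q)
    degree≡ = trans (θ-quotient 3) θ₃
    λ≡ : ((q ^ (2 * 3 ∸ 1) + q ^ 2) ∸ (q ^ (3 + 1) + q ^ 3)) / ((q ∸ 1) * (q ∸ 1)) ≡ q * q * suc q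
    λ≡ = trans (λ-quotient 1) qθ₁*qθ₂
    order≡ : 2 * suc (suc (q * suc q) * q) ≡ 2 * ((q ^ (3 + 1) ∸ 1) / (q ∸ 1))
    order≡ = cong (2 *_) (sym (trans (θ-quotient 4) θ₄))

mainTheorem5 : (n : ℕ) → 3 ≤ n → (F : Field) → (r : ℕ) →
    HasCount (λ (_ : Field.Carrier F) → ⊤) (2 + r) →
    let q = 2 + r
        G = PG.IncidenceGraph F n
    in (Bipartite G
        × IsEgr G (2 * ((q ^ (n + 1) ∸ 1) / (q ∸ 1)))
                  ((q ^ n ∸ 1) / (q ∸ 1))
                  4
                  (((q ^ (2 * n ∸ 1) + q ^ 2) ∸ (q ^ (n + 1) + q ^ n)) / ((q ∸ 1) * (q ∸ 1))))
       × (n ≡ 3 →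
          IsExtremalBipartiteEgr G (2 * ((q ^ (n + 1) ∸ 1) / (q ∸ 1)))
                                   ((q ^ n ∸ 1) / (q ∸ 1))
                                   4
                                   (((q ^ (2 * n ∸ 1) + q ^ 2) ∸ (q ^ (n + 1) + q ^ n)) / ((q ∸ 1) * (q ∸ 1))))
mainTheorem5 (suc (suc m)) (s≤s (s≤s 1≤m)) F r #F =
  (Incidence.bipartite F r #F m , incidence-isEgr F r #F m 1≤m) , λ { refl → incidence-extremal F r #F }
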